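{- A daisy has treewidth $4$ if it is a full $k$-daisy with $k\ge 5$, treewidth $2$ if it has no petal, and treewidth $3$ otherwise.
   Context: Graphs are finite and simple; a path means an induced path. A hole is a chordless cycle of length at least $4$. For a hole $C=c_1\dots c_kc_1$ (indices mod $k$), a petal with respect to $C$ is a path $P=x\dots y$ disjoint from $C$ such that for some $i$: $x$ is adjacent to $c_{i-1}$, $y$ to $c_{i+1}$, $c_i$ is adjacent to at least one internal vertex of $P$, no edge of the path $c_{i-1}xPyc_{i+1}$ has both ends adjacent to $c_i$, and there are no other edges between $P$ and $C$; $c_i$ is its centre. A daisy is a graph formed by a hole $C$ and petals with respect to $C$, no two with the same centre, whose centres induce a (possibly empty) subpath of $C$ or all of $C$, with no edges other than those of $C$, the petals, and between petals and $C$ as described. It is a $k$-daisy if $C$ has length $k$, and full if every vertex of $C$ is the centre of a petal. -}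

module Defs where

open import Data.Nat using (ℕ; zero; suc; _+_; _∸_; _≤_; _<_)
open import Data.Nat.DivMod using (_mod_)
open import Data.Fin using (Fin; toℕ; fromℕ) renaming (zero to fzero; suc to fsuc)
open import Data.Fin.Subset using (Subset; _∈_; ∣_∣)
open import Data.Bool using (Bool; true; false)
open import Data.Product using (Σ; ∃; ∃-syntax; _×_; _,_)
open import Data.Sum using (_⊎_)
open import Data.Unit using (⊤)
open import Relation.Nullary using (¬_)
open import Relation.Binary.PropositionalEquality using (_≡_; _≢_)
open import Function.Bundles using (_⇔_)

record Graph (n : ℕ) : Set where
  field
    adj    : Fin n → Fin n → Bool
    sym    : ∀ u v → adj u v ≡ adj v u
    irrefl : ∀ u → adj u u ≡ false

Adj : ∀ {n} → Graph n → Fin n → Fin n → Set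
Adj G u v = Graph.adj G u v ≡ true

data Walk {m : ℕ} (R : Fin m → Fin m → Set) (S : Fin m → Set) : Fin m → Fin m → Set where
  here : ∀ {a} → S a → Walk R S a a
  step : ∀ {a b c} → S a → R a b → Walk R S b c → Walk R S a c

Connected : ∀ {m} → (Fin m → Fin m → Set) → (Fin m → Set) → Set
Connected R S = ∀ a b → S a → S b → Walk R S a b

DeleteEdge : ∀ {m} → (Fin m → Fin m → Set) → Fin m → Fin m → Fin m → Fin m → Set
DeleteEdge R a b u v = R u v × ¬ (u ≡ a × v ≡ b) × ¬ (u ≡ b × v ≡ a)

-- A tree: a connected graph in which deleting any edge disconnects it
-- (i.e. a minimally connected graph, equivalently connected and acyclic).
IsTree : ∀ {m} → Graph m → Set
IsTree T = Connected (Adj T) (λ _ → ⊤)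
         × (∀ a b → Adj T a b → ¬ Connected (DeleteEdge (Adj T) a b) (λ _ → ⊤))

record TreeDecomposition {n : ℕ} (G : Graph n) : Set where
  field
    t      : ℕ
    tree   : Graph (suc t)
    isTree : IsTree tree
    bag    : Fin (suc t) → Subset n
    vertexCovered : ∀ v → ∃[ x ] (v ∈ bag x)
    edgeCovered   : ∀ u v → Adj G u v → ∃[ x ] (u ∈ bag x × v ∈ bag x)
    coherent      : ∀ v → Connected (Adj tree) (λ x → v ∈ bag x)

WidthAtMost : ∀ {n} {G : Graph n} → TreeDecomposition G → ℕ → Set
WidthAtMost D w = ∀ x → ∣ TreeDecomposition.bag D x ∣ ≤ suc w

TreewidthAtMost : ∀ {n} → Graph n → ℕ → Set
TreewidthAtMost G w = Σ (TreeDecomposition G) λ D → WidthAtMost D w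

HasTreewidth : ∀ {n} → Graph n → ℕ → Set
HasTreewidth G w = TreewidthAtMost G w × (∀ w′ → TreewidthAtMost G w′ → w ≤ w′)

rot : ∀ {k} → Fin k → ℕ → Fin k
rot {suc k} i j = (toℕ i + j) mod (suc k)

nxt : ∀ {k} → Fin k → Fin k
nxt i = rot i 1

prv : ∀ {k} → Fin k → Fin k
prv {k} i = rot i (k ∸ 1)

record Petal {n k : ℕ} (G : Graph n) (c : Fin k → Fin n) (i : Fin k) : Set where
  field
    l : ℕ
    p : Fin (suc l) → Fin n
  x : Fin n
  x = p fzero
  y : Fin n
  y = p (fromℕ l)
  Internal : Fin (suc l) → Set
  Internal a = 0 < toℕ a × toℕ a < l
  AC : Fin n → Set
  AC v = Adj G (c i) v
  field
    p-injective : ∀ a b → p a ≡ p b → a ≡ b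
    p-path      : ∀ a b → Adj G (p a) (p b) ⇔ (toℕ b ≡ suc (toℕ a) ⊎ toℕ a ≡ suc (toℕ b))
    disjointC   : ∀ a j → p a ≢ c j
    x-prev      : Adj G x (c (prv i))
    y-next      : Adj G y (c (nxt i))
    centreAdj   : ∃[ a ] (Internal a × AC (p a))
    -- no edge of the path c_{i-1} x P y c_{i+1} has both ends adjacent to c_i
    noBoth-first : ¬ (AC (c (prv i)) × AC x)
    noBoth-mid   : ∀ a b → toℕ b ≡ suc (toℕ a) → ¬ (AC (p a) × AC (p b))
    noBoth-last  : ¬ (AC y × AC (c (nxt i)))
    noOther     : ∀ a j → Adj G (p a) (c j) →
                    (j ≡ prv i × a ≡ fzero)
                  ⊎ (j ≡ nxt i × a ≡ fromℕ l)
                  ⊎ (j ≡ i × Internal a)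

record Daisy {n : ℕ} (G : Graph n) : Set where
  field
    k      : ℕ
    4≤k    : 4 ≤ k
    c      : Fin k → Fin n
    c-injective : ∀ a b → c a ≡ c b → a ≡ b
    hole   : ∀ a b → Adj G (c a) (c b) ⇔ (b ≡ nxt a ⊎ a ≡ nxt b)
    m      : ℕ
    centre : Fin m → Fin k
    centre-injective : ∀ j j′ → centre j ≡ centre j′ → j ≡ j′
    centresArc : ∃[ s ] ∃[ len ] (len ≤ k ×
                   (∀ i → (∃[ j ] centre j ≡ i) ⇔ (∃[ u ] (u < len × i ≡ rot s u))))
    petal  : (j : Fin m) → Petal G c (centre j)
    petalsDisjoint : ∀ j j′ a b → j ≢ j′ →
                       Petal.p (petal j) a ≢ Petal.p (petal j′) b
    noPetalEdges   : ∀ j j′ a b → j ≢ j′ →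
                       ¬ Adj G (Petal.p (petal j) a) (Petal.p (petal j′) b)
    covers : ∀ v → (∃[ a ] c a ≡ v) ⊎ (∃[ j ] ∃[ a ] Petal.p (petal j) a ≡ v)

Full : ∀ {n} {G : Graph n} → Daisy G → Set
Full D = ∀ i → ∃[ j ] Daisy.centre D j ≡ i

NoPetal : ∀ {n} {G : Graph n} → Daisy G → Set
NoPetal D = Daisy.m D ≡ 0

-- Number the hole c_0 … c_{k-1} from an anchor.  A path of k − 1 nodes with bags
-- {c_0, c_{e+1}, c_{e+2}} decomposes the hole.  The petal p_0 … p_l centred at c_q hangs below a spine
-- node that holds, once c_{q-1} or c_1 is added to it, all of c_{q-1}, c_q, c_{q+1}, as a path of nodes
-- with bags {c_q, c_{q+1}, c_{q-1}, p_0} and {c_q, c_{q+1}, p_{i-1}, p_i}.  All bags have at most 5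
-- vertices, 4 if the anchor is not a centre, 3 if there are no petals, and a 4-hole has only 4 vertices.
--
-- Some bag of every tree decomposition meets all sets of a bramble (connected, pairwise
-- touching vertex sets), by the Helly property of subtrees of a tree; if the sets are disjoint, that bag
-- is as large as the bramble.  The sets {c_0}, {c_1} and {c_2, …, c_{k-1}} form a bramble.  If p_a is
-- adjacent to the centre c_0 of a petal, so do {c_0}, {p_a}, {c_1, p_{a+1}, …, p_l} and
-- {c_2, …, c_{k-1}, p_0, …, p_{a-1}}.  In a full 5-daisy, c_i with the petal centred at c_{i+1}, i < 5, pairwise touch.
-- For k ≥ 6 the arc c_0 … c_{k-5} splits, with the petals centred inside it, into two interleaved zigzag
-- paths; together with regions around c_{k-4}, …, c_{k-1} they give a six-set bramble none of whose
-- hitting sets has fewer than five vertices.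

module Submission where

open import Defs
open import Data.Bool as Bool using (Bool; true; false; _∨_; not)
open import Data.Bool.Properties using (∨-comm; ¬-not; not-injective)
open import Data.Empty using (⊥-elim) renaming (⊥ to Empty)
open import Data.Fin as Fin using (Fin; toℕ) renaming (zero to fzero; suc to fsuc)
open import Data.Fin.Patterns using (0F; 1F; 2F; 3F; 4F; 5F)
open import Data.Fin.Subset as Subset using (Subset; ∣_∣; _∪_; ⁅_⁆)
open import Data.Fin.Subset.Properties as SubsetP using (_∈?_)
open import Data.Fin.Properties as FinP using (+↔⊎; *↔×)
open import Data.List as List using (List; []; _∷_; length)
open import Data.List.Membership.Propositional using () renaming (_∈_ to _∈ₗ_)
open import Data.List.Extrema.Nat using (max; xs≤max)
open import Data.List.Relation.Unary.All as All using (All; []; _∷_)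
open import Data.List.Relation.Unary.AllPairs as AllPairs using (AllPairs; []; _∷_)
open import Data.List.Relation.Unary.AllPairs.Properties as AllPairsP using ()
open import Data.List.Relation.Unary.All.Properties as AllP using ()
open import Data.List.Relation.Unary.Any as Any using (Any; here; there)
open import Data.Nat using (ℕ; zero; suc; _+_; _*_; _∸_; _≤_; _<_; s≤s; z≤n; NonZero)
open import Data.Nat.DivMod using (_%_; %-distribˡ-+; m%n%n≡m%n; m%n<n; [m+n]%n≡m%n; m<n⇒m%n≡m)
open import Data.Nat.Induction using (<-wellFounded)
open import Data.Nat.Properties as ℕ using (≤-refl; ≤-trans; <-≤-trans; ≤-pred; <-irrefl)
open import Data.Product using (Σ; ∃; ∃-syntax; _×_; _,_; proj₁; proj₂)
open import Data.Sum using (_⊎_; inj₁; inj₂)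
open import Data.Sum.Function.Propositional using (_⊎-↔_)
open import Data.Unit using (tt)
open import Data.Vec using (tabulate; []; _∷_)
open import Data.Vec.Properties using (lookup∘tabulate; []=⇒lookup; lookup⇒[]=)
open import Function using (_∘_; case_of_)
open import Function.Bundles using (Equivalence; _↔_; Inverse)
open import Function.Properties.Inverse using (↔-refl; ↔-trans)
open import Induction.WellFounded using (Acc; acc)
open import Level using (0ℓ)
open import Relation.Nullary using (¬_; ¬?; Dec; yes; no; does)
open import Relation.Nullary.Decidable using (_×-dec_; _⊎-dec_; dec-true; dec-false)
open import Relation.Unary using (Pred; Decidable; Satisfiable; U; _∩_; _≬_; _⊥_; _⊆_)
  renaming (_∈_ to _∈ᵖ_; _∉_ to _∉ᵖ_; _∪_ to _∪ᵖ_)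
open import Relation.Unary.Properties using (≬-sym; _∪?_)
open import Relation.Binary.PropositionalEquality
open ≡-Reasoning

private
  variable
    n : ℕ

module _ {m} {R : Fin m → Fin m → Set} where

  start : ∀ {S a b} → Walk R S a b → S a
  start (here s)     = s
  start (step s _ _) = s

  end : ∀ {S a b} → Walk R S a b → S b
  end (here s)     = s
  end (step _ _ w) = end w

  infixr 5 _++ʷ_
  _++ʷ_ : ∀ {S a b c} → Walk R S a b → Walk R S b c → Walk R S a c
  here _     ++ʷ w′ = w′
  step s r w ++ʷ w′ = step s r (w ++ʷ w′)

  edgeʷ : ∀ {S a b} → S a → S b → R a b → Walk R S a b
  edgeʷ sa sb r = step sa r (here sb)

  lengthʷ : ∀ {S a b} → Walk R S a b → ℕ
  lengthʷ (here _)     = 0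
  lengthʷ (step _ _ w) = suc (lengthʷ w)

  mapˢ : ∀ {S S′ a b} → S ⊆ S′ → Walk R S a b → Walk R S′ a b
  mapˢ f (here s)     = here (f s)
  mapˢ f (step s r w) = step (f s) r (mapˢ f w)

  module _ (R-sym : ∀ {a b} → R a b → R b a) where

    reverseʷ : ∀ {S a b} → Walk R S a b → Walk R S b a
    reverseʷ (here s)     = here s
    reverseʷ (step s r w) = reverseʷ w ++ʷ edgeʷ (start w) s (R-sym r)

    connected-via : ∀ {S} h → (∀ a → S a → Walk R S a h) → Connected R S
    connected-via h to-h a b sa sb = to-h a sa ++ʷ reverseʷ (to-h b sb)

Adj-sym : (G : Graph n) → ∀ {u v} → Adj G u v → Adj G v u
Adj-sym G {u} {v} = trans (Graph.sym G v u)

bindʷ : ∀ {m} {R R′ : Fin m → Fin m → Set} {S S′ a b} →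
        (∀ {u v} → S u → S v → R u v → Walk R′ S′ u v) → (S ⊆ S′) → Walk R S a b → Walk R′ S′ a b
bindʷ f g (here s)     = here (g s)
bindʷ f g (step s r w) = f s (start w) r ++ʷ bindʷ f g w

-- The Helly property of subtrees

module _ {m} {R : Fin m → Fin m → Set} (x : Fin m) where

  after-last-visit : ∀ {S u z} (W : Walk R S u z) → z ≢ x →
      (Σ (Walk R (S ∩ (_≢ x)) u z) λ V → lengthʷ V ≤ lengthʷ W)
    ⊎ (∃[ w ] R x w × Σ (Walk R (S ∩ (_≢ x)) w z) λ V → lengthʷ V < lengthʷ W)
  after-last-visit (here s) z≢x = inj₁ (here (s , z≢x) , z≤n)
  after-last-visit {u = u} (step s r W) z≢x with after-last-visit W z≢x
  ... | inj₂ (w , xw , V , V<W) = inj₂ (w , xw , V , ℕ.m<n⇒m<1+n V<W)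
  ... | inj₁ (V , V≤W) with u Fin.≟ x
  ...   | yes refl = inj₂ (_ , r , V , s≤s V≤W)
  ...   | no u≢x   = inj₁ (step (s , u≢x) r V , s≤s V≤W)

  last-exit : ∀ {S z} (W : Walk R S x z) → z ≢ x →
              ∃[ w ] R x w × Σ (Walk R (S ∩ (_≢ x)) w z) λ V → lengthʷ V < lengthʷ W
  last-exit W z≢x with after-last-visit W z≢x
  ... | inj₁ (V , _) = ⊥-elim (proj₂ (start V) refl)
  ... | inj₂ exit    = exit

module Tree {t} (T : Graph (suc t)) (T-tree : IsTree T) where

  A : Fin (suc t) → Fin (suc t) → Set
  A = Adj T

  A-sym : ∀ {x y} → A x y → A y x
  A-sym = Adj-sym T

  -- Such a walk would close a cycle through the edge {x , a}, which then would not be a bridge.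
  neighbours-separated : ∀ {x a b} → A x a → A x b → a ≢ b → ¬ Walk A (_≢ x) a b
  neighbours-separated {x} {a} {b} xa xb a≢b W = proj₂ T-tree x a xa still-connected
    where
      A⁻ : Fin (suc t) → Fin (suc t) → Set
      A⁻ = DeleteEdge A x a

      A⁻-sym : ∀ {u v} → A⁻ u v → A⁻ v u
      A⁻-sym (r , p , q) = A-sym r , (λ (u≡ , v≡) → q (v≡ , u≡)) , (λ (u≡ , v≡) → p (v≡ , u≡))

      detour : Walk A⁻ U a x
      detour = bindʷ (λ u≢x v≢x r → edgeʷ tt tt (r , (λ (u≡x , _) → u≢x u≡x) , λ (_ , v≡x) → v≢x v≡x)) (λ _ → tt) W
               ++ʷ edgeʷ tt tt (A-sym xb , (λ (b≡x , _) → end W b≡x) , λ (b≡a , _) → a≢b (sym b≡a))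

      reroute : ∀ {u v} → U u → U v → A u v → Walk A⁻ U u v
      reroute {u} {v} _ _ r with u Fin.≟ x ×-dec v Fin.≟ a | u Fin.≟ a ×-dec v Fin.≟ x
      ... | yes (refl , refl) | _                 = reverseʷ A⁻-sym detour
      ... | no _              | yes (refl , refl) = detour
      ... | no p              | no q              = edgeʷ tt tt (r , p , q)

      still-connected : Connected A⁻ U
      still-connected u v _ _ = bindʷ reroute (λ _ → tt) (proj₁ T-tree u v tt tt)

  step-towards-stays-in : ∀ {X Y : Pred (Fin (suc t)) 0ℓ} {x w y} → Connected A X → Connected A Y → X ≬ Y →
                    x ∈ᵖ X → x ∉ᵖ Y → y ∈ᵖ Y → A x w → Walk A (_≢ x) w y → w ∈ᵖ X
  step-towards-stays-in {x = x} {w} {y} X-conn Y-conn (z , z∈X , z∈Y) x∈X x∉Y y∈Y xw V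
    with last-exit x (X-conn x z x∈X z∈X) (λ { refl → x∉Y z∈Y })
  ... | w′ , xw′ , U′ , _ with w′ Fin.≟ w
  ...   | yes refl = proj₁ (start U′)
  ...   | no w′≢w  = ⊥-elim (neighbours-separated xw′ xw w′≢w
                       (mapˢ proj₂ U′ ++ʷ mapˢ (λ { v∈Y refl → x∉Y v∈Y }) (Y-conn z y z∈Y y∈Y)
                        ++ʷ reverseʷ A-sym V))

  module _ {Xs : List (Pred (Fin (suc t)) 0ℓ)} {Y : Pred (Fin (suc t)) 0ℓ}
           (Xs-conn : All (Connected A) Xs) (Y-conn : Connected A Y) (Y? : Decidable Y)
           (Xs≬Y : All (_≬ Y) Xs) where

    -- Walking from a common node of the Xs towards Y never leaves their intersection.
    reach-common : ∀ {S x y} → All (x ∈ᵖ_) Xs → y ∈ᵖ Y → (W : Walk A S x y) → Acc _<_ (lengthʷ W) →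
                   ∃[ z ] z ∈ᵖ Y × All (z ∈ᵖ_) Xs
    reach-common {x = x} x∈Xs y∈Y W (acc shorter) with Y? x
    ... | yes x∈Y = x , x∈Y , x∈Xs
    ... | no x∉Y with last-exit x W (λ { refl → x∉Y y∈Y })
    ...   | w , xw , V , V<W =
      reach-common (All.zipWith (λ (X-conn , X≬Y , x∈X) →
                      step-towards-stays-in X-conn Y-conn X≬Y x∈X x∉Y y∈Y xw (mapˢ proj₂ V))
                    (Xs-conn , All.zip (Xs≬Y , x∈Xs)))
                   y∈Y V (shorter V<W)

  helly : ∀ {Xs : List (Pred (Fin (suc t)) 0ℓ)} → All Decidable Xs → All (Connected A) Xs →
          All Satisfiable Xs → AllPairs _≬_ Xs → ∃[ x ] All (x ∈ᵖ_) Xs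
  helly []                  []                  []                 []               = fzero , []
  helly (X? ∷ Xs?) (X-conn ∷ Xs-conn) ((y , y∈X) ∷ Xs-sat) (X≬Xs ∷ Xs-pairs)
    with helly Xs? Xs-conn Xs-sat Xs-pairs
  ... | x , x∈Xs with reach-common Xs-conn X-conn X? (All.map ≬-sym X≬Xs) x∈Xs y∈X
                        (proj₁ T-tree x y tt tt) (<-wellFounded _)
  ...   | z , z∈X , z∈Xs = z , z∈X ∷ z∈Xs

-- Brambles

data Touching (G : Graph n) (P Q : Pred (Fin n) 0ℓ) : Set where
  sharing  : P ≬ Q → Touching G P Q
  adjacent : ∀ {u v} → P u → Q v → Adj G u v → Touching G P Q

record Bramble (G : Graph n) : Set₁ where
  field
    sets      : List (Pred (Fin n) 0ℓ)
    decidable : All Decidable sets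
    connected : All (Connected (Adj G)) sets
    nonempty  : All Satisfiable sets
    touching  : AllPairs (Touching G) sets

∪-connected : ∀ {G : Graph n} {P Q} → Connected (Adj G) P → Connected (Adj G) Q → Touching G P Q →
              Connected (Adj G) (P ∪ᵖ Q)
∪-connected {G = G} {P} {Q} P-conn Q-conn (sharing (u , u∈P , u∈Q)) = connected-via (Adj-sym G) u λ where
  v (inj₁ v∈P) → mapˢ inj₁ (P-conn v u v∈P u∈P)
  v (inj₂ v∈Q) → mapˢ inj₂ (Q-conn v u v∈Q u∈Q)
∪-connected {G = G} {P} {Q} P-conn Q-conn (adjacent {u} {u′} u∈P u′∈Q uu′) = connected-via (Adj-sym G) u λ where
  v (inj₁ v∈P) → mapˢ inj₁ (P-conn v u v∈P u∈P)
  v (inj₂ v∈Q) → mapˢ inj₂ (Q-conn v u′ v∈Q u′∈Q) ++ʷ edgeʷ (inj₂ u′∈Q) (inj₁ u∈P) (Adj-sym G uu′)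

Meets : Subset n → Pred (Fin n) 0ℓ → Set
Meets p P = (Subset._∈ p) ≬ P

module _ {G : Graph n} (D : TreeDecomposition G) where
  open TreeDecomposition D

  nodes-meeting : Pred (Fin n) 0ℓ → Pred (Fin (suc t)) 0ℓ
  nodes-meeting P x = Meets (bag x) P

  nodes-meeting? : ∀ {P} → Decidable P → Decidable (nodes-meeting P)
  nodes-meeting? P? x = FinP.any? λ u → (u ∈? bag x) ×-dec P? u

  walk-nodes : ∀ {P u v} → Walk (Adj G) P u v → ∀ {x y} → u Subset.∈ bag x → v Subset.∈ bag y →
               Walk (Adj tree) (nodes-meeting P) x y
  walk-nodes (here u∈P) u∈x u∈y = mapˢ (λ u∈z → _ , u∈z , u∈P) (coherent _ _ _ u∈x u∈y)
  walk-nodes (step u∈P uv W) u∈x v∈y with edgeCovered _ _ uv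
  ... | z , u∈z , v∈z = mapˢ (λ u∈z′ → _ , u∈z′ , u∈P) (coherent _ _ _ u∈x u∈z) ++ʷ walk-nodes W v∈z v∈y

  nodes-meeting-connected : ∀ {P} → Connected (Adj G) P → Connected (Adj tree) (nodes-meeting P)
  nodes-meeting-connected P-conn x y (u , u∈x , u∈P) (v , v∈y , v∈P) = walk-nodes (P-conn u v u∈P v∈P) u∈x v∈y

  nodes-meeting-overlap : ∀ {P Q} → Touching G P Q → nodes-meeting P ≬ nodes-meeting Q
  nodes-meeting-overlap (sharing (u , u∈P , u∈Q)) with vertexCovered u
  ... | x , u∈x = x , (u , u∈x , u∈P) , (u , u∈x , u∈Q)
  nodes-meeting-overlap (adjacent u∈P v∈Q uv) with edgeCovered _ _ uv
  ... | x , u∈x , v∈x = x , (_ , u∈x , u∈P) , (_ , v∈x , v∈Q)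

  nodes-meeting-nonempty : ∀ {P} → Satisfiable P → Satisfiable (nodes-meeting P)
  nodes-meeting-nonempty (u , u∈P) with vertexCovered u
  ... | x , u∈x = x , u , u∈x , u∈P

  bag-meeting-bramble : (B : Bramble G) → ∃[ x ] All (Meets (bag x)) (Bramble.sets B)
  bag-meeting-bramble B =
    let open Bramble B
        x , x∈nodes = Tree.helly tree isTree
          (AllP.map⁺ (All.map nodes-meeting? decidable)) (AllP.map⁺ (All.map nodes-meeting-connected connected))
          (AllP.map⁺ (All.map nodes-meeting-nonempty nonempty))
          (AllPairsP.map⁺ (AllPairs.map nodes-meeting-overlap touching))
    in x , AllP.map⁻ x∈nodes

hits-of-disjoint : (p : Subset n) {Ps : List (Pred (Fin n) 0ℓ)} →
                   AllPairs _⊥_ Ps → All (Meets p) Ps → length Ps ≤ ∣ p ∣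
hits-of-disjoint p [] [] = z≤n
hits-of-disjoint p {P ∷ Ps} (P⊥Ps ∷ Ps-disj) ((u , u∈p , u∈P) ∷ Ps-hit) =
  <-≤-trans (s≤s (hits-of-disjoint (p Subset.- u) Ps-disj (All.zipWith still-hit (P⊥Ps , Ps-hit))))
            (SubsetP.x∈p⇒∣p-x∣<∣p∣ u∈p)
  where
    still-hit : ∀ {Q} → P ⊥ Q × Meets p Q → Meets (p Subset.- u) Q
    still-hit (P⊥Q , v , v∈p , v∈Q) =
      v , SubsetP.x∈p∧x≢y⇒x∈p-y v∈p (λ { refl → P⊥Q (u∈P , v∈Q) }) , v∈Q

meets-∪ : ∀ {p : Subset n} {P Q} → Meets p (P ∪ᵖ Q) → Meets p P ⊎ Meets p Q
meets-∪ (u , u∈p , inj₁ u∈P) = inj₁ (u , u∈p , u∈P)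
meets-∪ (u , u∈p , inj₂ u∈Q) = inj₂ (u , u∈p , u∈Q)

hits-with-pairwise-unions : (p : Subset n) {P Q R : Pred (Fin n) 0ℓ} {Ps : List (Pred (Fin n) 0ℓ)} →
                            AllPairs _⊥_ (P ∷ Q ∷ R ∷ Ps) → All (Meets p) Ps →
                            Meets p (P ∪ᵖ Q) → Meets p (P ∪ᵖ R) → Meets p (Q ∪ᵖ R) → 2 + length Ps ≤ ∣ p ∣
hits-with-pairwise-unions p {P} {Q} {R} {Ps} ((P⊥Q ∷ P⊥R ∷ P⊥Ps) ∷ (Q⊥R ∷ Q⊥Ps) ∷ R⊥Ps ∷ Ps-disj) Ps-hit PQ PR QR =
  two-of (meets-∪ PQ) (meets-∪ PR) (meets-∪ QR)
  where
    two : ∀ {X Y} → X ⊥ Y → All (X ⊥_) Ps → All (Y ⊥_) Ps → Meets p X → Meets p Y → 2 + length Ps ≤ ∣ p ∣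
    two X⊥Y X⊥Ps Y⊥Ps X-hit Y-hit = hits-of-disjoint p ((X⊥Y ∷ X⊥Ps) ∷ Y⊥Ps ∷ Ps-disj) (X-hit ∷ Y-hit ∷ Ps-hit)

    two-of : Meets p P ⊎ Meets p Q → Meets p P ⊎ Meets p R → Meets p Q ⊎ Meets p R → 2 + length Ps ≤ ∣ p ∣
    two-of (inj₁ P-hit) (inj₂ R-hit) _            = two P⊥R P⊥Ps R⊥Ps P-hit R-hit
    two-of (inj₁ P-hit) (inj₁ _)     (inj₁ Q-hit) = two P⊥Q P⊥Ps Q⊥Ps P-hit Q-hit
    two-of (inj₁ P-hit) (inj₁ _)     (inj₂ R-hit) = two P⊥R P⊥Ps R⊥Ps P-hit R-hit
    two-of (inj₂ Q-hit) (inj₁ P-hit) _            = two P⊥Q P⊥Ps Q⊥Ps P-hit Q-hit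
    two-of (inj₂ Q-hit) (inj₂ R-hit) _            = two Q⊥R Q⊥Ps R⊥Ps Q-hit R-hit

disjoint-bramble-bound : ∀ {G : Graph n} {w} (B : Bramble G) → AllPairs _⊥_ (Bramble.sets B) →
                         TreewidthAtMost G w → length (Bramble.sets B) ≤ suc w
disjoint-bramble-bound B disjoint (D , narrow) with bag-meeting-bramble D B
... | x , hits = ≤-trans (hits-of-disjoint _ disjoint hits) (narrow x)

-- Tree decompositions from parent pointers

record RootedTree (N : Set) : Set where
  field
    root             : N
    parent           : N → N
    depth            : N → ℕ
    parent-shallower : ∀ {x} → x ≢ root → depth (parent x) < depth x

record RootedDecomposition {N : Set} (G : Graph n) (T : RootedTree N) : Set₁ where
  open RootedTree T
  field
    InBag        : N → Pred (Fin n) 0ℓ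
    InBag?       : ∀ x → Decidable (InBag x)
    highest      : ∀ v → ∃[ h ] InBag h v × (∀ {x} → InBag x v → x ≢ h → x ≢ root × InBag (parent x) v)
    edge-covered : ∀ {u v} → Adj G u v → ∃[ x ] InBag x u × InBag x v

module RootedTreeGraph {t} (T : RootedTree (Fin (suc t))) where
  open RootedTree T

  IsParent : Fin (suc t) → Fin (suc t) → Set
  IsParent x y = x ≢ root × parent x ≡ y

  IsParent? : ∀ x y → Dec (IsParent x y)
  IsParent? x y = ¬? (x Fin.≟ root) ×-dec (parent x Fin.≟ y)

  not-own-parent : ∀ x → ¬ IsParent x x
  not-own-parent x (x≢root , px≡x) = <-irrefl (cong depth px≡x) (parent-shallower x≢root)

  graph : Graph (suc t)
  graph = record
    { adj    = λ x y → does (IsParent? x y) ∨ does (IsParent? y x)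
    ; sym    = λ x y → ∨-comm (does (IsParent? x y)) _
    ; irrefl = λ x → cong (λ b → b ∨ b) (dec-false (IsParent? x x) (not-own-parent x)) }

  parent-edge : ∀ {x} → x ≢ root → Adj graph x (parent x)
  parent-edge {x} x≢root = cong (_∨ does (IsParent? (parent x) x)) (dec-true (IsParent? x (parent x)) (x≢root , refl))

  edge-cases : ∀ {x y} → Adj graph x y → IsParent x y ⊎ IsParent y x
  edge-cases {x} {y} xy with IsParent? x y | IsParent? y x
  ... | yes p | _     = inj₁ p
  ... | no _  | yes q = inj₂ q
  ... | no ¬p | no ¬q
    with () ← trans (sym (cong₂ _∨_ (dec-false (IsParent? x y) ¬p) (dec-false (IsParent? y x) ¬q))) xy

  climbing-connected : ∀ {S : Pred (Fin (suc t)) 0ℓ} h → (∀ {x} → S x → x ≢ h → x ≢ root × S (parent x)) →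
                       Connected (Adj graph) S
  climbing-connected {S} h up = connected-via (λ {u} {v} → Adj-sym graph {u} {v}) h (λ x x∈S → climb-to x∈S (<-wellFounded _))
    where
      climb-to : ∀ {x} → S x → Acc _<_ (depth x) → Walk (Adj graph) S x h
      climb-to {x} x∈S (acc shallower) with x Fin.≟ h
      ... | yes refl = here x∈S
      ... | no x≢h   = let x≢root , px∈S = up x∈S x≢h in
        step x∈S (parent-edge x≢root) (climb-to px∈S (shallower (parent-shallower x≢root)))

  data Descendant (a : Fin (suc t)) : Fin (suc t) → Set where
    itself : Descendant a a
    child  : ∀ {y} → y ≢ root → Descendant a (parent y) → Descendant a y

  descendant-deeper : ∀ {a y} → Descendant a y → depth a ≤ depth y
  descendant-deeper itself            = ≤-refl
  descendant-deeper (child y≢root d) = ≤-trans (descendant-deeper d) (ℕ.<⇒≤ (parent-shallower y≢root))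

  stays-below : ∀ {R : Fin (suc t) → Fin (suc t) → Set} {a} →
                (∀ {u v} → R u v → Adj graph u v × ¬ (u ≡ a × v ≡ parent a)) →
                ∀ {y z} → Descendant a y → Walk R U y z → Descendant a z
  stays-below no-up d (here _) = d
  stays-below no-up {y} d (step {b = v} _ r W) with no-up {y} {v} r
  ... | uv , not-up with edge-cases {y} {v} uv
  ...   | inj₂ (v≢root , refl) = stays-below no-up (child v≢root d) W
  ...   | inj₁ (_ , refl) with d
  ...     | itself     = ⊥-elim (not-up (refl , refl))
  ...     | child _ d′ = stays-below no-up d′ W

  is-tree : IsTree graph
  is-tree = climbing-connected root (λ _ x≢root → x≢root , tt) , every-edge-a-bridge
    where
      parent-not-below : ∀ {a} → a ≢ root → ¬ Descendant a (parent a)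
      parent-not-below a≢root d = <-irrefl refl (<-≤-trans (parent-shallower a≢root) (descendant-deeper d))

      every-edge-a-bridge : ∀ a b → Adj graph a b → ¬ Connected (DeleteEdge (Adj graph) a b) U
      every-edge-a-bridge a b ab conn with edge-cases {a} {b} ab
      ... | inj₁ (a≢root , refl) =
        parent-not-below a≢root (stays-below (λ (r , no-up , _) → r , no-up) itself (conn a (parent a) tt tt))
      ... | inj₂ (b≢root , refl) =
        parent-not-below b≢root (stays-below (λ (r , _ , no-up) → r , no-up) itself (conn b (parent b) tt tt))

∣p∪q∣≤∣p∣+∣q∣ : (p q : Subset n) → ∣ p ∪ q ∣ ≤ ∣ p ∣ + ∣ q ∣
∣p∪q∣≤∣p∣+∣q∣ []          []          = z≤n
∣p∪q∣≤∣p∣+∣q∣ (true ∷ p)  (true ∷ q)  = s≤s (≤-trans (∣p∪q∣≤∣p∣+∣q∣ p q) (ℕ.+-monoʳ-≤ ∣ p ∣ (ℕ.n≤1+n ∣ q ∣)))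
∣p∪q∣≤∣p∣+∣q∣ (true ∷ p)  (false ∷ q) = s≤s (∣p∪q∣≤∣p∣+∣q∣ p q)
∣p∪q∣≤∣p∣+∣q∣ (false ∷ p) (true ∷ q)  = ≤-trans (s≤s (∣p∪q∣≤∣p∣+∣q∣ p q)) (ℕ.≤-reflexive (sym (ℕ.+-suc ∣ p ∣ ∣ q ∣)))
∣p∪q∣≤∣p∣+∣q∣ (false ∷ p) (false ∷ q) = ∣p∪q∣≤∣p∣+∣q∣ p q

∣p∣≤length : ∀ {n} (p : Subset n) (vs : List (Fin n)) → (∀ {v} → v Subset.∈ p → v ∈ₗ vs) → ∣ p ∣ ≤ length vs
∣p∣≤length {n} p vs p⊆vs = ≤-trans (SubsetP.p⊆q⇒∣p∣≤∣q∣ (∈-listed ∘ p⊆vs)) (∣listed∣≤length vs)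
  where
    listed : List (Fin n) → Subset n
    listed []       = Subset.⊥
    listed (v ∷ vs) = ⁅ v ⁆ ∪ listed vs

    ∈-listed : ∀ {v vs} → v ∈ₗ vs → v Subset.∈ listed vs
    ∈-listed {vs = u ∷ _}  (here refl) = SubsetP.x∈p∪q⁺ (inj₁ (SubsetP.x∈⁅x⁆ u))
    ∈-listed {vs = _ ∷ vs} (there v∈vs) = SubsetP.x∈p∪q⁺ (inj₂ (∈-listed v∈vs))

    ∣listed∣≤length : ∀ vs → ∣ listed vs ∣ ≤ length vs
    ∣listed∣≤length []       = ℕ.≤-reflexive (SubsetP.∣⊥∣≡0 n)
    ∣listed∣≤length (v ∷ vs) = ≤-trans (∣p∪q∣≤∣p∣+∣q∣ ⁅ v ⁆ (listed vs))
      (subst (λ s → s + ∣ listed vs ∣ ≤ suc (length vs)) (sym (SubsetP.∣⁅x⁆∣≡1 v)) (s≤s (∣listed∣≤length vs)))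

module _ {t} {T : RootedTree (Fin (suc t))} {G : Graph n} (R : RootedDecomposition G T) where
  open RootedTree T
  open RootedDecomposition R
  open RootedTreeGraph T

  private
    bag : Fin (suc t) → Subset n
    bag x = tabulate (λ v → does (InBag? x v))

    ∈-bag⁺ : ∀ {x v} → InBag x v → v Subset.∈ bag x
    ∈-bag⁺ {x} {v} v∈x = lookup⇒[]= v (bag x) (trans (lookup∘tabulate _ v) (dec-true (InBag? x v) v∈x))

    ∈-bag⁻ : ∀ {x v} → v Subset.∈ bag x → InBag x v
    ∈-bag⁻ {x} {v} v∈x with InBag? x v | trans (sym (lookup∘tabulate (λ u → does (InBag? x u)) v)) ([]=⇒lookup v∈x)
    ... | yes p | _ = p
    ... | no _  | ()

  rooted-decomposition : TreeDecomposition G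
  rooted-decomposition = record
    { t             = t
    ; tree          = graph
    ; isTree        = is-tree
    ; bag           = bag
    ; vertexCovered = λ v → let h , v∈h , _ = highest v in h , ∈-bag⁺ v∈h
    ; edgeCovered   = λ u v uv → let x , u∈x , v∈x = edge-covered uv in x , ∈-bag⁺ u∈x , ∈-bag⁺ v∈x
    ; coherent      = λ v a b v∈a v∈b → let h , _ , climb = highest v in
        mapˢ ∈-bag⁺ (climbing-connected h climb a b (∈-bag⁻ v∈a) (∈-bag⁻ v∈b)) }

  rooted-treewidth≤ : ∀ {w} → (∀ x → ∃[ vs ] length vs ≤ suc w × (∀ {v} → InBag x v → v ∈ₗ vs)) →
                      TreewidthAtMost G w
  rooted-treewidth≤ listing = rooted-decomposition , λ x →
    let vs , vs≤ , InBag⊆vs = listing x in ≤-trans (∣p∣≤length (bag x) vs (InBag⊆vs ∘ ∈-bag⁻)) vs≤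

module _ {N : Set} {t} (enc : Fin (suc t) ↔ N) where
  open Inverse enc using (to; from; strictlyInverseˡ; strictlyInverseʳ)

  private
    to≡⇒≡from : ∀ {x y} → to x ≡ y → x ≡ from y
    to≡⇒≡from {x} refl = sym (strictlyInverseʳ x)

    ≡from⇒to≡ : ∀ {x y} → x ≡ from y → to x ≡ y
    ≡from⇒to≡ {y = y} refl = strictlyInverseˡ y

  pull-tree : RootedTree N → RootedTree (Fin (suc t))
  pull-tree T = record
    { root             = from root
    ; parent           = from ∘ parent ∘ to
    ; depth            = depth ∘ to
    ; parent-shallower = λ {x} x≢root →
        subst (λ y → depth y < depth (to x)) (sym (strictlyInverseˡ _)) (parent-shallower (x≢root ∘ to≡⇒≡from)) }
    where
      open RootedTree T

  pull-decomposition : ∀ {G : Graph n} {T : RootedTree N} → RootedDecomposition G T → RootedDecomposition G (pull-tree T)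
  pull-decomposition {T = T} R = record
    { InBag        = InBag ∘ to
    ; InBag?       = InBag? ∘ to
    ; highest      = λ v → let h , v∈h , climb = highest v in
        from h , subst (λ y → InBag y v) (sym (strictlyInverseˡ h)) v∈h , λ {x} v∈x x≢h →
          let x≢root , v∈parent = climb v∈x (x≢h ∘ to≡⇒≡from) in
          x≢root ∘ ≡from⇒to≡ , subst (λ y → InBag y v) (sym (strictlyInverseˡ _)) v∈parent
    ; edge-covered = λ uv → let x , u∈x , v∈x = edge-covered uv in from x ,
        subst (λ y → InBag y _) (sym (strictlyInverseˡ x)) u∈x , subst (λ y → InBag y _) (sym (strictlyInverseˡ x)) v∈x }
    where
      open RootedTree T
      open RootedDecomposition R

[m%d+n]%d≡[m+n]%d : ∀ m n d .{{_ : NonZero d}} → (m % d + n) % d ≡ (m + n) % d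
[m%d+n]%d≡[m+n]%d m n d = begin
  (m % d + n) % d         ≡⟨ %-distribˡ-+ (m % d) n d ⟩
  (m % d % d + n % d) % d ≡⟨ cong (λ x → (x + n % d) % d) (m%n%n≡m%n m d) ⟩
  (m % d + n % d) % d     ≡⟨ %-distribˡ-+ m n d ⟨
  (m + n) % d             ∎

toℕ-rot : ∀ {k} (r : Fin (suc k)) (q : ℕ) → toℕ (rot r q) ≡ (toℕ r + q) % suc k
toℕ-rot {k} r q = FinP.toℕ-fromℕ< (m%n<n (toℕ r + q) (suc k))

rot-cong : ∀ {k} (r : Fin (suc k)) {q q′ : ℕ} → (toℕ r + q) % suc k ≡ (toℕ r + q′) % suc k → rot r q ≡ rot r q′
rot-cong {k} r {q} {q′} eq = FinP.toℕ-injective (trans (toℕ-rot r q) (trans eq (sym (toℕ-rot r q′))))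

rot-rot : ∀ {k} (r : Fin k) (a b : ℕ) → rot (rot r a) b ≡ rot r (a + b)
rot-rot {suc k} r a b = FinP.toℕ-injective (begin
  toℕ (rot (rot r a) b)       ≡⟨ toℕ-rot (rot r a) b ⟩
  (toℕ (rot r a) + b) % suc k ≡⟨ cong (λ x → (x + b) % suc k) (toℕ-rot r a) ⟩
  ((toℕ r + a) % suc k + b) % suc k ≡⟨ [m%d+n]%d≡[m+n]%d (toℕ r + a) b (suc k) ⟩
  (toℕ r + a + b) % suc k     ≡⟨ cong (_% suc k) (ℕ.+-assoc (toℕ r) a b) ⟩
  (toℕ r + (a + b)) % suc k   ≡⟨ toℕ-rot r (a + b) ⟨
  toℕ (rot r (a + b))         ∎)

rot-+k : ∀ {k} (r : Fin k) (q : ℕ) → rot r (q + k) ≡ rot r q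
rot-+k {suc k} r q = rot-cong r (begin
  (toℕ r + (q + suc k)) % suc k ≡⟨ cong (_% suc k) (ℕ.+-assoc (toℕ r) q (suc k)) ⟨
  (toℕ r + q + suc k) % suc k   ≡⟨ [m+n]%n≡m%n (toℕ r + q) (suc k) ⟩
  (toℕ r + q) % suc k           ∎)

rot-0 : ∀ {k} (r : Fin k) → rot r 0 ≡ r
rot-0 {suc k} r = FinP.toℕ-injective (begin
  toℕ (rot r 0)         ≡⟨ toℕ-rot r 0 ⟩
  (toℕ r + 0) % suc k   ≡⟨ cong (_% suc k) (ℕ.+-identityʳ (toℕ r)) ⟩
  toℕ r % suc k         ≡⟨ m<n⇒m%n≡m (FinP.toℕ<n r) ⟩
  toℕ r                 ∎)

rot-comm : ∀ {k} (r s : Fin k) → rot r (toℕ s) ≡ rot s (toℕ r)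
rot-comm {suc k} r s = FinP.toℕ-injective (begin
  toℕ (rot r (toℕ s))       ≡⟨ toℕ-rot r (toℕ s) ⟩
  (toℕ r + toℕ s) % suc k   ≡⟨ cong (_% suc k) (ℕ.+-comm (toℕ r) (toℕ s)) ⟩
  (toℕ s + toℕ r) % suc k   ≡⟨ toℕ-rot s (toℕ r) ⟨
  toℕ (rot s (toℕ r))       ∎)

nxt-rot : ∀ {k} (r : Fin k) (q : ℕ) → nxt (rot r q) ≡ rot r (suc q)
nxt-rot r q = trans (rot-rot r q 1) (cong (rot r) (ℕ.+-comm q 1))

prv-rot : ∀ {k} (r : Fin k) (q : ℕ) → prv (rot r (suc q)) ≡ rot r q
prv-rot {suc k} r q = begin
  rot (rot r (suc q)) k ≡⟨ rot-rot r (suc q) k ⟩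
  rot r (suc q + k)     ≡⟨ cong (rot r) (ℕ.+-suc q k) ⟨
  rot r (q + suc k)     ≡⟨ rot-+k r q ⟩
  rot r q               ∎

-- The q < k with rot r q ≡ a.
offset : ∀ {k} → Fin k → Fin k → ℕ
offset {k} r a = toℕ (rot a (k ∸ toℕ r))

offset<k : ∀ {k} (r a : Fin k) → offset r a < k
offset<k {k} r a = FinP.toℕ<n (rot a (k ∸ toℕ r))

rot-offset : ∀ {k} (r a : Fin k) → rot r (offset r a) ≡ a
rot-offset {suc k} r a = begin
  rot r (offset r a)                      ≡⟨ rot-comm r _ ⟩
  rot (rot a (suc k ∸ toℕ r)) (toℕ r)     ≡⟨ rot-rot a _ (toℕ r) ⟩
  rot a (suc k ∸ toℕ r + toℕ r)           ≡⟨ cong (rot a) (ℕ.m∸n+n≡m (ℕ.<⇒≤ (FinP.toℕ<n r))) ⟩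
  rot a (0 + suc k)                       ≡⟨ rot-+k a 0 ⟩
  rot a 0                                 ≡⟨ rot-0 a ⟩
  a                                       ∎

offset-rot : ∀ {k} (r : Fin k) {q : ℕ} → q < k → offset r (rot r q) ≡ q
offset-rot {suc k} r {q} q<k = begin
  toℕ (rot (rot r q) (suc k ∸ toℕ r))    ≡⟨ cong toℕ (rot-rot r q _) ⟩
  toℕ (rot r (q + (suc k ∸ toℕ r)))      ≡⟨ toℕ-rot r _ ⟩
  (toℕ r + (q + (suc k ∸ toℕ r))) % suc k ≡⟨ cong (_% suc k) (rearrange (toℕ r) q (FinP.toℕ<n r)) ⟩
  (q + suc k) % suc k                     ≡⟨ [m+n]%n≡m%n q (suc k) ⟩
  q % suc k                               ≡⟨ m<n⇒m%n≡m q<k ⟩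
  q                                       ∎
  where
    rearrange : ∀ x q → x < suc k → x + (q + (suc k ∸ x)) ≡ q + suc k
    rearrange x q x<k = begin
      x + (q + (suc k ∸ x)) ≡⟨ ℕ.+-assoc x q _ ⟨
      x + q + (suc k ∸ x)   ≡⟨ cong (_+ (suc k ∸ x)) (ℕ.+-comm x q) ⟩
      q + x + (suc k ∸ x)   ≡⟨ ℕ.+-assoc q x _ ⟩
      q + (x + (suc k ∸ x)) ≡⟨ cong (q +_) (ℕ.m+[n∸m]≡n (ℕ.<⇒≤ x<k)) ⟩
      q + suc k             ∎

rot-injective : ∀ {k} (r : Fin k) {q q′ : ℕ} → q < k → q′ < k → rot r q ≡ rot r q′ → q ≡ q′
rot-injective r q<k q′<k eq = trans (sym (offset-rot r q<k)) (trans (cong (offset r) eq) (offset-rot r q′<k))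

rot-suc-injective : ∀ {k} (r : Fin k) {q q′ : ℕ} → q < k → q′ < k → rot r (suc q) ≡ rot r (suc q′) → q ≡ q′
rot-suc-injective r {q} {q′} q<k q′<k eq =
  rot-injective r q<k q′<k (trans (sym (prv-rot r q)) (trans (cong prv eq) (prv-rot r q′)))

even : ℕ → Bool
even zero          = true
even (suc zero)    = false
even (suc (suc n)) = even n

even-suc : ∀ n → even (suc n) ≡ not (even n)
even-suc zero          = refl
even-suc (suc zero)    = refl
even-suc (suc (suc n)) = even-suc n

clamp : ∀ l → ℕ → Fin (suc l)
clamp l       zero    = fzero
clamp zero    (suc i) = fzero
clamp (suc l) (suc i) = fsuc (clamp l i)

toℕ-clamp : ∀ l {i} → i ≤ l → toℕ (clamp l i) ≡ i
toℕ-clamp l       {zero}  _         = refl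
toℕ-clamp (suc l) {suc i} (s≤s i≤l) = cong suc (toℕ-clamp l i≤l)

clamp-toℕ : ∀ l (i : Fin (suc l)) → clamp l (toℕ i) ≡ i
clamp-toℕ l       fzero    = refl
clamp-toℕ (suc l) (fsuc i) = cong fsuc (clamp-toℕ l i)

clamp-self : ∀ l → clamp l l ≡ Fin.fromℕ l
clamp-self zero    = refl
clamp-self (suc l) = cong fsuc (clamp-self l)

module DaisyGeometry {G : Graph n} (D : Daisy G) where
  open Daisy D public

  adj-sym : ∀ {u v} → Adj G u v → Adj G v u
  adj-sym = Adj-sym G

  len : Fin m → ℕ
  len j = Petal.l (petal j)

  -- Indices past the end of a petal give its last vertex.
  pv : Fin m → ℕ → Fin n
  pv j i = Petal.p (petal j) (clamp (len j) i)

  pv-toℕ : ∀ j (i : Fin (suc (len j))) → pv j (toℕ i) ≡ Petal.p (petal j) i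
  pv-toℕ j i = cong (Petal.p (petal j)) (clamp-toℕ (len j) i)

  pv-adj : ∀ j {i} → i < len j → Adj G (pv j i) (pv j (suc i))
  pv-adj j {i} i<len = Equivalence.from (Petal.p-path (petal j) _ _)
    (inj₁ (trans (toℕ-clamp (len j) i<len) (cong suc (sym (toℕ-clamp (len j) (ℕ.<⇒≤ i<len))))))

  centre-neighbour : ∀ j → ∃[ i ] suc i < len j × Adj G (c (centre j)) (pv j (suc i))
  centre-neighbour j with Petal.centreAdj (petal j)
  ... | fzero  , (() , _)      , _
  ... | fsuc i , (_ , 1+i<len) , adj = toℕ i , 1+i<len , subst (Adj G (c (centre j))) (sym (pv-toℕ j (fsuc i))) adj

  pv≢c : ∀ j i a → Petal.p (petal j) i ≢ c a
  pv≢c j = Petal.disjointC (petal j)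

  same-petal : ∀ {j j′ i i′} → Petal.p (petal j) i ≡ Petal.p (petal j′) i′ → j ≡ j′
  same-petal {j} {j′} {i} {i′} eq with j Fin.≟ j′
  ... | yes j≡j′ = j≡j′
  ... | no j≢j′  = ⊥-elim (petalsDisjoint j j′ i i′ j≢j′ eq)

  IsCentre : Pred (Fin k) 0ℓ
  IsCentre a = ∃[ j ] centre j ≡ a

  IsCentre? : Decidable IsCentre
  IsCentre? a = FinP.any? λ j → centre j Fin.≟ a

  0<k : 0 < k
  0<k = ≤-trans (s≤s z≤n) 4≤k

  k≡1+[k∸1] : k ≡ suc (k ∸ 1)
  k≡1+[k∸1] = sym (ℕ.m+[n∸m]≡n 0<k)

  -- A set of vertices described by offsets on the hole (from an anchor fixed later) and indices on the petals.
  record Region : Set₁ where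
    field
      onHole   : Pred ℕ 0ℓ
      onHole?  : Decidable onHole
      onPetal  : Fin m → Pred ℕ 0ℓ
      onPetal? : ∀ j → Decidable (onPetal j)
  open Region public

  hole-only : (P : Pred ℕ 0ℓ) → Decidable P → Region
  hole-only P P? = record { onHole = P ; onHole? = P? ; onPetal = λ _ _ → Empty ; onPetal? = λ _ _ → no λ () }

  r₀ : Fin k
  r₀ = Fin.fromℕ< 0<k

  module Anchored (r : Fin k) where

    C : ℕ → Fin n
    C q = c (rot r q)

    C-adj : ∀ q → Adj G (C q) (C (suc q))
    C-adj q = Equivalence.from (hole (rot r q) (rot r (suc q))) (inj₁ (sym (nxt-rot r q)))

    C-+k : ∀ q → C (q + k) ≡ C q
    C-+k q = cong c (rot-+k r q)

    C-k : C k ≡ C 0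
    C-k = C-+k 0

    C-last-adj : Adj G (C (k ∸ 1)) (C 0)
    C-last-adj = subst (Adj G (C (k ∸ 1))) (trans (cong C (sym k≡1+[k∸1])) C-k) (C-adj (k ∸ 1))

    first-adj : ∀ j {q} → centre j ≡ rot r (suc q) → Adj G (pv j 0) (C q)
    first-adj j {q} eq = subst (λ a → Adj G (pv j 0) (c a)) (trans (cong prv eq) (prv-rot r q)) (Petal.x-prev (petal j))

    last-adj : ∀ j {q} → centre j ≡ rot r q → Adj G (pv j (len j)) (C (suc q))
    last-adj j {q} eq = subst₂ (λ u a → Adj G u (c a)) (cong (Petal.p (petal j)) (sym (clamp-self (len j))))
                          (trans (cong nxt eq) (nxt-rot r q)) (Petal.y-next (petal j))

    cycle-walk : ∀ {S : Pred (Fin n) 0ℓ} {a b} → a ≤ b → (∀ {i} → a ≤ i → i ≤ b → S (C i)) →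
                 Walk (Adj G) S (C b) (C a)
    cycle-walk {a = a} {b} a≤b inside with ℕ.m≤n⇒m<n∨m≡n a≤b
    ... | inj₂ refl = here (inside ≤-refl ≤-refl)
    cycle-walk {b = suc b} _ inside | inj₁ (s≤s a≤b) =
      step (inside (ℕ.m≤n⇒m≤1+n a≤b) ≤-refl) (adj-sym (C-adj b)) (cycle-walk a≤b λ a≤i i≤b → inside a≤i (ℕ.m≤n⇒m≤1+n i≤b))

    petal-walk : ∀ {S : Pred (Fin n) 0ℓ} j {a b} → a ≤ b → b ≤ len j → (∀ {i} → a ≤ i → i ≤ b → S (pv j i)) →
                 Walk (Adj G) S (pv j b) (pv j a)
    petal-walk j {a} {b} a≤b b≤len inside with ℕ.m≤n⇒m<n∨m≡n a≤b
    ... | inj₂ refl = here (inside ≤-refl ≤-refl)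
    petal-walk j {b = suc b} _ b<len inside | inj₁ (s≤s a≤b) =
      step (inside (ℕ.m≤n⇒m≤1+n a≤b) ≤-refl) (adj-sym (pv-adj j b<len))
           (petal-walk j a≤b (ℕ.<⇒≤ b<len) λ a≤i i≤b → inside a≤i (ℕ.m≤n⇒m≤1+n i≤b))

    petal⇝prev : ∀ {S : Pred (Fin n) 0ℓ} j {q i} → centre j ≡ rot r (suc q) → i ≤ len j →
                 (∀ {i′} → i′ ≤ i → S (pv j i′)) → S (C q) → Walk (Adj G) S (pv j i) (C q)
    petal⇝prev j centre≡ i≤len inside Cq∈S =
      petal-walk j z≤n i≤len (λ _ i′≤i → inside i′≤i) ++ʷ edgeʷ (inside z≤n) Cq∈S (first-adj j centre≡)

    petal⇝next : ∀ {S : Pred (Fin n) 0ℓ} j {q i} → centre j ≡ rot r q → i ≤ len j →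
                 (∀ {i′} → i ≤ i′ → i′ ≤ len j → S (pv j i′)) → S (C (suc q)) → Walk (Adj G) S (pv j i) (C (suc q))
    petal⇝next j centre≡ i≤len inside Cq∈S =
      reverseʷ adj-sym (petal-walk j i≤len ≤-refl inside) ++ʷ edgeʷ (inside i≤len ≤-refl) Cq∈S (last-adj j centre≡)

    ⟦_⟧ : Region → Pred (Fin n) 0ℓ
    ⟦ S ⟧ v = (∃[ a ] c a ≡ v × onHole S (offset r a))
            ⊎ (∃[ j ] ∃[ i ] Petal.p (petal j) i ≡ v × onPetal S j (toℕ i))

    ⟦_⟧? : ∀ S → Decidable ⟦ S ⟧
    ⟦ S ⟧? v = FinP.any? (λ a → (c a Fin.≟ v) ×-dec onHole? S (offset r a))
          ⊎-dec FinP.any? (λ j → FinP.any? λ i → (Petal.p (petal j) i Fin.≟ v) ×-dec onPetal? S j (toℕ i))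

    C∈ : ∀ S {q} → q < k → onHole S q → ⟦ S ⟧ (C q)
    C∈ S q<k q∈S = inj₁ (_ , refl , subst (onHole S) (sym (offset-rot r q<k)) q∈S)

    pv∈ : ∀ S j {i} → i ≤ len j → onPetal S j i → ⟦ S ⟧ (pv j i)
    pv∈ S j i≤len i∈S = inj₂ (j , _ , refl , subst (onPetal S j) (sym (toℕ-clamp (len j) i≤len)) i∈S)

    regions-disjoint : ∀ S S′ → (∀ {q} → onHole S q → ¬ onHole S′ q) → (∀ {j i} → onPetal S j i → ¬ onPetal S′ j i) →
                       ⟦ S ⟧ ⊥ ⟦ S′ ⟧
    regions-disjoint S S′ hole-disjoint petal-disjoint = λ where
      (inj₁ (a , refl , a∈S) , inj₁ (a′ , ca′≡ca , a′∈S′)) → case c-injective a′ a ca′≡ca of λ where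
        refl → hole-disjoint a∈S a′∈S′
      (inj₁ (a , refl , _) , inj₂ (j , i , pi≡ca , _)) → pv≢c j i a pi≡ca
      (inj₂ (j , i , refl , _) , inj₁ (a , ca≡pi , _)) → pv≢c j i a (sym ca≡pi)
      (inj₂ (j , i , refl , i∈S) , inj₂ (j′ , i′ , pi′≡pi , i′∈S′)) → case same-petal pi′≡pi of λ where
        refl → case Petal.p-injective (petal j) i′ i pi′≡pi of λ where
          refl → petal-disjoint i∈S i′∈S′

    region-connected : ∀ S {hub} →
                       (∀ {q} → q < k → onHole S q → Walk (Adj G) ⟦ S ⟧ (C q) hub) →
                       (∀ j {i} → i ≤ len j → onPetal S j i → Walk (Adj G) ⟦ S ⟧ (pv j i) hub) →
                       Connected (Adj G) ⟦ S ⟧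
    region-connected S {hub} from-hole from-petal = connected-via adj-sym hub λ where
      _ (inj₁ (a , refl , a∈S)) →
        subst (λ u → Walk (Adj G) ⟦ S ⟧ u hub) (cong c (rot-offset r a)) (from-hole (offset<k r a) a∈S)
      _ (inj₂ (j , i , refl , i∈S)) →
        subst (λ u → Walk (Adj G) ⟦ S ⟧ u hub) (pv-toℕ j i) (from-petal j (≤-pred (FinP.toℕ<n i)) i∈S)

-- Lower bounds

module LowerBounds {G : Graph n} (D : Daisy G) where
  open DaisyGeometry D

  1<k : 1 < k
  1<k = ≤-trans (s≤s (s≤s z≤n)) 4≤k

  2<k : 2 < k
  2<k = ≤-trans (s≤s (s≤s (s≤s z≤n))) 4≤k

  k∸1<k : k ∸ 1 < k
  k∸1<k = subst (k ∸ 1 <_) (sym k≡1+[k∸1]) ≤-refl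

  2≤k∸1 : 2 ≤ k ∸ 1
  2≤k∸1 = ℕ.∸-monoˡ-≤ 1 (≤-trans (s≤s (s≤s (s≤s z≤n))) 4≤k)

  hole-lower-bound : ∀ w → TreewidthAtMost G w → 2 ≤ w
  hole-lower-bound w tw = ≤-pred (disjoint-bramble-bound bramble disjoint tw)
    where
      open Anchored r₀

      S₀ S₁ S₂ : Region
      S₀ = hole-only (_≡ 0) (ℕ._≟ 0)
      S₁ = hole-only (_≡ 1) (ℕ._≟ 1)
      S₂ = hole-only (2 ≤_) (2 ℕ.≤?_)

      C₀∈S₀ : ⟦ S₀ ⟧ (C 0)
      C₀∈S₀ = C∈ S₀ 0<k refl

      C₁∈S₁ : ⟦ S₁ ⟧ (C 1)
      C₁∈S₁ = C∈ S₁ 1<k refl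

      C₂∈S₂ : ⟦ S₂ ⟧ (C 2)
      C₂∈S₂ = C∈ S₂ 2<k ≤-refl

      bramble : Bramble G
      bramble = record
        { sets      = ⟦ S₀ ⟧ ∷ ⟦ S₁ ⟧ ∷ ⟦ S₂ ⟧ ∷ []
        ; decidable = ⟦ S₀ ⟧? ∷ ⟦ S₁ ⟧? ∷ ⟦ S₂ ⟧? ∷ []
        ; connected = region-connected S₀ (λ { _ refl → here C₀∈S₀ }) (λ _ _ ())
                    ∷ region-connected S₁ (λ { _ refl → here C₁∈S₁ }) (λ _ _ ())
                    ∷ region-connected S₂ (λ q<k 2≤q → cycle-walk 2≤q λ 2≤i i≤q → C∈ S₂ (ℕ.≤-<-trans i≤q q<k) 2≤i)
                        (λ _ _ ())
                    ∷ []
        ; nonempty  = (_ , C₀∈S₀) ∷ (_ , C₁∈S₁) ∷ (_ , C₂∈S₂) ∷ []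
        ; touching  = (adjacent C₀∈S₀ C₁∈S₁ (C-adj 0) ∷ adjacent C₀∈S₀ (C∈ S₂ k∸1<k 2≤k∸1) (adj-sym C-last-adj) ∷ [])
                    ∷ (adjacent C₁∈S₁ C₂∈S₂ (C-adj 1) ∷ [])
                    ∷ [] ∷ [] }

      disjoint : AllPairs _⊥_ (Bramble.sets bramble)
      disjoint = (regions-disjoint S₀ S₁ (λ { refl () }) (λ ()) ∷ regions-disjoint S₀ S₂ (λ { refl () }) (λ ()) ∷ [])
               ∷ (regions-disjoint S₁ S₂ (λ { refl (s≤s ()) }) (λ ()) ∷ [])
               ∷ [] ∷ []

  petal-lower-bound : Fin m → ∀ w → TreewidthAtMost G w → 3 ≤ w
  petal-lower-bound j₀ w tw = ≤-pred (disjoint-bramble-bound bramble disjoint tw)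
    where
      open Anchored (centre j₀)

      a₀ : ℕ
      a₀ = suc (proj₁ (centre-neighbour j₀))

      a₀<len : a₀ < len j₀
      a₀<len = proj₁ (proj₂ (centre-neighbour j₀))

      C₀-a₀ : Adj G (C 0) (pv j₀ a₀)
      C₀-a₀ = subst (λ a → Adj G (c a) (pv j₀ a₀)) (sym (rot-0 (centre j₀))) (proj₂ (proj₂ (centre-neighbour j₀)))

      centre≡rot-k : centre j₀ ≡ rot (centre j₀) (suc (k ∸ 1))
      centre≡rot-k = sym (trans (cong (rot (centre j₀)) (sym k≡1+[k∸1])) (trans (rot-+k (centre j₀) 0) (rot-0 (centre j₀))))

      S₀ S₁ S₂ S₃ : Region
      S₀ = hole-only (_≡ 0) (ℕ._≟ 0)
      S₁ = record { onHole = 2 ≤_ ; onHole? = 2 ℕ.≤?_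
                  ; onPetal = λ j i → j ≡ j₀ × i < a₀ ; onPetal? = λ j i → (j Fin.≟ j₀) ×-dec (i ℕ.<? a₀) }
      S₂ = record { onHole = λ _ → Empty ; onHole? = λ _ → no λ ()
                  ; onPetal = λ j i → j ≡ j₀ × i ≡ a₀ ; onPetal? = λ j i → (j Fin.≟ j₀) ×-dec (i ℕ.≟ a₀) }
      S₃ = record { onHole = _≡ 1 ; onHole? = ℕ._≟ 1
                  ; onPetal = λ j i → j ≡ j₀ × a₀ < i ; onPetal? = λ j i → (j Fin.≟ j₀) ×-dec (a₀ ℕ.<? i) }

      C₀∈S₀ : ⟦ S₀ ⟧ (C 0)
      C₀∈S₀ = C∈ S₀ 0<k refl

      C₂∈S₁ : ⟦ S₁ ⟧ (C 2)
      C₂∈S₁ = C∈ S₁ 2<k ≤-refl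

      a₀∈S₂ : ⟦ S₂ ⟧ (pv j₀ a₀)
      a₀∈S₂ = pv∈ S₂ j₀ (ℕ.<⇒≤ a₀<len) (refl , refl)

      C₁∈S₃ : ⟦ S₃ ⟧ (C 1)
      C₁∈S₃ = C∈ S₃ 1<k refl

      hole⇝C₂ : ∀ {q} → q < k → 2 ≤ q → Walk (Adj G) ⟦ S₁ ⟧ (C q) (C 2)
      hole⇝C₂ q<k 2≤q = cycle-walk 2≤q λ 2≤i i≤q → C∈ S₁ (ℕ.≤-<-trans i≤q q<k) 2≤i

      before-a₀ : ∀ {i} → i < a₀ → ∀ {i′} → i′ ≤ i → ⟦ S₁ ⟧ (pv j₀ i′)
      before-a₀ i<a₀ i′≤i = pv∈ S₁ j₀ (≤-trans i′≤i (ℕ.<⇒≤ (ℕ.<-trans i<a₀ a₀<len))) (refl , ℕ.≤-<-trans i′≤i i<a₀)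

      after-a₀ : ∀ {i} → a₀ < i → ∀ {i′} → i ≤ i′ → i′ ≤ len j₀ → ⟦ S₃ ⟧ (pv j₀ i′)
      after-a₀ a₀<i i≤i′ i′≤len = pv∈ S₃ j₀ i′≤len (refl , <-≤-trans a₀<i i≤i′)

      bramble : Bramble G
      bramble = record
        { sets      = ⟦ S₀ ⟧ ∷ ⟦ S₁ ⟧ ∷ ⟦ S₂ ⟧ ∷ ⟦ S₃ ⟧ ∷ []
        ; decidable = ⟦ S₀ ⟧? ∷ ⟦ S₁ ⟧? ∷ ⟦ S₂ ⟧? ∷ ⟦ S₃ ⟧? ∷ []
        ; connected = region-connected S₀ (λ { _ refl → here C₀∈S₀ }) (λ _ _ ())
                    ∷ region-connected S₁ hole⇝C₂ (λ { _ i≤len (refl , i<a₀) →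
                        petal⇝prev j₀ centre≡rot-k i≤len (before-a₀ i<a₀) (C∈ S₁ k∸1<k 2≤k∸1)
                        ++ʷ hole⇝C₂ k∸1<k 2≤k∸1 })
                    ∷ region-connected S₂ (λ _ ()) (λ { _ _ (refl , refl) → here a₀∈S₂ })
                    ∷ region-connected S₃ (λ { _ refl → here C₁∈S₃ }) (λ { _ i≤len (refl , a₀<i) →
                        petal⇝next j₀ (sym (rot-0 (centre j₀))) i≤len (after-a₀ a₀<i) C₁∈S₃ })
                    ∷ []
        ; nonempty  = (_ , C₀∈S₀) ∷ (_ , C₂∈S₁) ∷ (_ , a₀∈S₂) ∷ (_ , C₁∈S₃) ∷ []
        ; touching  = (adjacent C₀∈S₀ (C∈ S₁ k∸1<k 2≤k∸1) (adj-sym C-last-adj)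
                       ∷ adjacent C₀∈S₀ a₀∈S₂ C₀-a₀
                       ∷ adjacent C₀∈S₀ C₁∈S₃ (C-adj 0) ∷ [])
                    ∷ (adjacent (before-a₀ ≤-refl ≤-refl) a₀∈S₂ (pv-adj j₀ (ℕ.<⇒≤ a₀<len)) ∷ adjacent C₂∈S₁ C₁∈S₃ (adj-sym (C-adj 1)) ∷ [])
                    ∷ (adjacent a₀∈S₂ (after-a₀ ≤-refl ≤-refl a₀<len) (pv-adj j₀ a₀<len) ∷ [])
                    ∷ [] ∷ [] }

      disjoint : AllPairs _⊥_ (Bramble.sets bramble)
      disjoint = ( regions-disjoint S₀ S₁ (λ { refl () }) (λ ())
                 ∷ regions-disjoint S₀ S₂ (λ _ ()) (λ ())
                 ∷ regions-disjoint S₀ S₃ (λ { refl () }) (λ ()) ∷ [])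
               ∷ ( regions-disjoint S₁ S₂ (λ _ ()) (λ { (_ , i<a₀) (_ , refl) → <-irrefl refl i<a₀ })
                 ∷ regions-disjoint S₁ S₃ (λ { 2≤q refl → ℕ.<-irrefl refl (≤-pred 2≤q) }) (λ (_ , i<a₀) (_ , a₀<i) → ℕ.<-asym i<a₀ a₀<i)
                 ∷ [])
               ∷ (regions-disjoint S₂ S₃ (λ ()) (λ { (_ , refl) (_ , a₀<a₀) → <-irrefl refl a₀<a₀ }) ∷ [])
               ∷ [] ∷ []

  module _ (full : Full D) where
    open Anchored r₀

    petal-at : ℕ → Fin m
    petal-at q = proj₁ (full (rot r₀ q))

    centre-petal-at : ∀ q → centre (petal-at q) ≡ rot r₀ q
    centre-petal-at q = proj₂ (full (rot r₀ q))

    last-of : ℕ → Fin n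
    last-of q = pv (petal-at q) (len (petal-at q))

    last-of-adj : ∀ q → Adj G (last-of q) (C (suc q))
    last-of-adj q = last-adj (petal-at q) (centre-petal-at q)

    -- X i is c_i with the petal centred at c_{i+1}; it touches X (i+1) by a hole edge and X (i+2) by that petal's end.
    pentagon-lower-bound : k ≡ 5 → ∀ w → TreewidthAtMost G w → 4 ≤ w
    pentagon-lower-bound k≡5 w tw = ≤-pred (disjoint-bramble-bound bramble disjoint tw)
      where
        <5⇒<k : ∀ {q} → q < 5 → q < k
        <5⇒<k {q} = subst (q <_) (sym k≡5)

        C-+5 : ∀ q → C (q + 5) ≡ C q
        C-+5 q = subst (λ k′ → C (q + k′) ≡ C q) k≡5 (C-+k q)

        X : Fin 5 → Region
        X i = record { onHole = _≡ toℕ i ; onHole? = ℕ._≟ toℕ i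
                     ; onPetal = λ j _ → centre j ≡ rot r₀ (suc (toℕ i))
                     ; onPetal? = λ j _ → centre j Fin.≟ rot r₀ (suc (toℕ i)) }

        C∈X : ∀ i → ⟦ X i ⟧ (C (toℕ i))
        C∈X i = C∈ (X i) (<5⇒<k (FinP.toℕ<n i)) refl

        last∈X : ∀ i → ⟦ X i ⟧ (last-of (suc (toℕ i)))
        last∈X i = pv∈ (X i) (petal-at (suc (toℕ i))) ≤-refl (centre-petal-at (suc (toℕ i)))

        X-connected : ∀ i → Connected (Adj G) ⟦ X i ⟧
        X-connected i = region-connected (X i) (λ { _ refl → here (C∈X i) }) λ j i≤len centre≡ →
          petal⇝prev j centre≡ i≤len (λ i′≤i → pv∈ (X i) j (≤-trans i′≤i i≤len) centre≡) (C∈X i)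

        X-disjoint : ∀ {i i′} → i ≢ i′ → ⟦ X i ⟧ ⊥ ⟦ X i′ ⟧
        X-disjoint {i} {i′} i≢i′ = regions-disjoint (X i) (X i′)
          (λ { refl i≡i′ → i≢i′ (FinP.toℕ-injective i≡i′) })
          (λ centre≡ centre≡′ → i≢i′ (FinP.toℕ-injective (rot-suc-injective r₀ (<5⇒<k (FinP.toℕ<n i))
                                  (<5⇒<k (FinP.toℕ<n i′)) (trans (sym centre≡) centre≡′))))

        bramble : Bramble G
        bramble = record
          { sets      = List.tabulate (⟦_⟧ ∘ X)
          ; decidable = AllP.tabulate⁺ {f = ⟦_⟧ ∘ X} (⟦_⟧? ∘ X)
          ; connected = AllP.tabulate⁺ {f = ⟦_⟧ ∘ X} X-connected
          ; nonempty  = AllP.tabulate⁺ {f = ⟦_⟧ ∘ X} (λ i → _ , C∈X i)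
          ; touching  =
              ( adjacent (C∈X 0F) (C∈X 1F) (C-adj 0)
              ∷ adjacent (last∈X 0F) (C∈X 2F) (last-of-adj 1)
              ∷ adjacent (C∈X 0F) (last∈X 3F) (adj-sym (subst (Adj G _) (C-+5 0) (last-of-adj 4)))
              ∷ adjacent (C∈X 0F) (C∈X 4F) (adj-sym (subst (Adj G _) (C-+5 0) (C-adj 4)))
              ∷ [])
            ∷ ( adjacent (C∈X 1F) (C∈X 2F) (C-adj 1)
              ∷ adjacent (last∈X 1F) (C∈X 3F) (last-of-adj 2)
              ∷ adjacent (C∈X 1F) (last∈X 4F) (adj-sym (subst (Adj G _) (C-+5 1) (last-of-adj 5)))
              ∷ [])
            ∷ ( adjacent (C∈X 2F) (C∈X 3F) (C-adj 2)
              ∷ adjacent (last∈X 2F) (C∈X 4F) (last-of-adj 3)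
              ∷ [])
            ∷ (adjacent (C∈X 3F) (C∈X 4F) (C-adj 3) ∷ [])
            ∷ [] ∷ [] }

        disjoint : AllPairs _⊥_ (Bramble.sets bramble)
        disjoint = AllPairsP.tabulate⁺ {f = ⟦_⟧ ∘ X} X-disjoint

    -- A, B, Cʳ and A′ lie around c_{2+d}, …, c_{5+d}; Z true and Z false are the two zigzag paths through the
    -- arc c_0 … c_{1+d}.  The bramble is A, B, Cʳ and the pairwise unions of A′, Z true, Z false.
    module LongHole (d : ℕ) (k≡6+d : k ≡ 6 + d) where

      D₀ : ℕ
      D₀ = suc d

      <6+d⇒<k : ∀ {q} → q < 6 + d → q < k
      <6+d⇒<k {q} = subst (q <_) (sym k≡6+d)

      C-wrap : ∀ q → C (q + (6 + d)) ≡ C q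
      C-wrap q = subst (λ k′ → C (q + k′) ≡ C q) k≡6+d (C-+k q)

      same-centre : ∀ {j} (b b′ : Fin 6) → centre j ≡ rot r₀ (suc (toℕ b + d)) → centre j ≡ rot r₀ (suc (toℕ b′ + d)) →
                    b ≡ b′
      same-centre b b′ centre≡ centre≡′ = FinP.toℕ-injective (ℕ.+-cancelʳ-≡ d _ _
        (rot-suc-injective r₀ (<6+d⇒<k (ℕ.+-monoˡ-< d (FinP.toℕ<n b))) (<6+d⇒<k (ℕ.+-monoˡ-< d (FinP.toℕ<n b′)))
                           (trans (sym centre≡) centre≡′)))

      around : Fin 6 → List (Fin 6) → Region
      around a bs = record
        { onHole   = _≡ toℕ a + d
        ; onHole?  = ℕ._≟ toℕ a + d
        ; onPetal  = λ j _ → Any (λ b → centre j ≡ rot r₀ (suc (toℕ b + d))) bs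
        ; onPetal? = λ j _ → Any.any? (λ b → centre j Fin.≟ rot r₀ (suc (toℕ b + d))) bs }

      A B Cʳ A′ : Region
      A  = around 2F (2F ∷ 0F ∷ [])
      B  = around 3F (3F ∷ 1F ∷ [])
      Cʳ = around 4F (4F ∷ [])
      A′ = around 5F (5F ∷ [])

      centre∈around : ∀ a {bs} → ⟦ around a bs ⟧ (C (toℕ a + d))
      centre∈around a = C∈ (around a _) (<6+d⇒<k (ℕ.+-monoˡ-< d (FinP.toℕ<n a))) refl

      around-connected : ∀ a {bs} → All (λ b → b ≡ a ⊎ 2 + toℕ b ≡ toℕ a) bs → Connected (Adj G) ⟦ around a bs ⟧
      around-connected a {bs} beside = region-connected (around a bs) (λ { _ refl → here (centre∈around a) })
        λ j i≤len b∈bs → let on-petal = λ {i′} i′≤len → pv∈ (around a bs) j {i′} i′≤len b∈bs in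
        case All.lookupAny beside b∈bs of λ where
          (inj₁ refl , centre≡) → petal⇝prev j centre≡ i≤len (λ i′≤i → on-petal (≤-trans i′≤i i≤len)) (centre∈around a)
          (inj₂ 2+b≡a , centre≡) → subst (λ q → Walk (Adj G) ⟦ around a bs ⟧ (pv j _) (C (q + d))) 2+b≡a
            (petal⇝next j centre≡ i≤len (λ _ i′≤len → on-petal i′≤len)
              (subst (λ q → ⟦ around a bs ⟧ (C (q + d))) (sym 2+b≡a) (centre∈around a)))

      around-disjoint : ∀ {a a′ bs bs′} → a ≢ a′ → All (λ b → All (b ≢_) bs′) bs → ⟦ around a bs ⟧ ⊥ ⟦ around a′ bs′ ⟧
      around-disjoint {a} {a′} {bs} {bs′} a≢a′ apart = regions-disjoint (around a bs) (around a′ bs′)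
        (λ { refl eq → a≢a′ (FinP.toℕ-injective (ℕ.+-cancelʳ-≡ d _ _ eq)) })
        (λ b∈bs b′∈bs′ → let b≢bs′ , centre≡ = All.lookupAny apart b∈bs
                             b≢b′ , centre≡′ = All.lookupAny b≢bs′ b′∈bs′
                         in b≢b′ (same-centre _ _ centre≡ centre≡′))

      OnZ : Bool → Pred ℕ 0ℓ
      OnZ b q = ∃ λ f → f < suc D₀ × (q + f ≡ D₀ × even f ≡ b)

      OnZ? : ∀ b → Decidable (OnZ b)
      OnZ? b q = ℕ.anyUpTo? (λ f → (q + f ℕ.≟ D₀) ×-dec (even f Bool.≟ b)) (suc D₀)

      -- the hole vertices c_q, q ≤ 1 + d, with 1 + d − q of parity b, and the petals following them inside the arc
      Z : Bool → Region
      Z b = record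
        { onHole   = OnZ b
        ; onHole?  = OnZ? b
        ; onPetal  = λ j _ → ∃ λ q → q < d × (centre j ≡ rot r₀ (suc q) × OnZ b q)
        ; onPetal? = λ j _ → ℕ.anyUpTo? (λ q → (centre j Fin.≟ rot r₀ (suc q)) ×-dec OnZ? b q) d }

      on-Z : ∀ {b q} f → q + f ≡ D₀ → even f ≡ b → OnZ b q
      on-Z {q = q} f q+f≡D₀ even≡ = f , s≤s (ℕ.m+n≤o⇒n≤o q (ℕ.≤-reflexive q+f≡D₀)) , q+f≡D₀ , even≡

      C∈Z : ∀ {b q} f → q + f ≡ D₀ → even f ≡ b → ⟦ Z b ⟧ (C q)
      C∈Z {q = q} f q+f≡D₀ even≡ =
        C∈ (Z _) (<6+d⇒<k (s≤s (≤-trans (ℕ.m+n≤o⇒m≤o q (ℕ.≤-reflexive q+f≡D₀)) (ℕ.m≤n+m D₀ 4)))) (on-Z f q+f≡D₀ even≡)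

      hub : Bool → ℕ
      hub true  = D₀
      hub false = d

      hub∈Z : ∀ b → ⟦ Z b ⟧ (C (hub b))
      hub∈Z true  = C∈Z 0 (ℕ.+-identityʳ D₀) refl
      hub∈Z false = C∈Z 1 (ℕ.+-comm d 1) refl

      +2 : ∀ {q f} → q + suc (suc f) ≡ D₀ → suc (suc q) + f ≡ D₀
      +2 {q} {f} eq = trans (sym (trans (ℕ.+-suc q (suc f)) (cong suc (ℕ.+-suc q f)))) eq

      zigzag : ∀ {b} f {q} → q + f ≡ D₀ → even f ≡ b → Walk (Adj G) ⟦ Z b ⟧ (C q) (C (hub b))
      zigzag zero {q} q+0≡D₀ refl =
        subst (λ x → Walk (Adj G) ⟦ Z true ⟧ (C x) (C D₀)) (trans (sym q+0≡D₀) (ℕ.+-identityʳ q)) (here (hub∈Z true))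
      zigzag (suc zero) {q} q+1≡D₀ refl =
        subst (λ x → Walk (Adj G) ⟦ Z false ⟧ (C x) (C d)) (ℕ.suc-injective (trans (sym q+1≡D₀) (ℕ.+-comm q 1)))
              (here (hub∈Z false))
      zigzag {b} (suc (suc f)) {q} q+f≡D₀ even≡ =
        step (C∈Z _ q+f≡D₀ even≡) (adj-sym (first-adj P centre≡))
             (petal⇝next P centre≡ z≤n (λ _ i≤len → pv∈ (Z b) P i≤len (q , q<d , centre≡ , on-Z _ q+f≡D₀ even≡))
                         (C∈Z f (+2 q+f≡D₀) even≡)
              ++ʷ zigzag f (+2 q+f≡D₀) even≡)
        where
          P : Fin m
          P = petal-at (suc q)

          centre≡ : centre P ≡ rot r₀ (suc q)
          centre≡ = centre-petal-at (suc q)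

          q<d : q < d
          q<d = ℕ.m+n≤o⇒m≤o (suc q) (ℕ.≤-pred (ℕ.≤-reflexive (+2 q+f≡D₀)))

      q+1≡D₀⇒q≡d : ∀ {q} → q + 1 ≡ D₀ → q ≡ d
      q+1≡D₀⇒q≡d {q} q+1≡D₀ = ℕ.suc-injective (trans (ℕ.+-comm 1 q) q+1≡D₀)

      Z-connected : ∀ b → Connected (Adj G) ⟦ Z b ⟧
      Z-connected b = region-connected (Z b) (λ _ (f , _ , q+f≡D₀ , even≡) → zigzag f q+f≡D₀ even≡) from-petal
        where
          from-petal : ∀ j {i} → i ≤ len j → onPetal (Z b) j i → Walk (Adj G) ⟦ Z b ⟧ (pv j i) (C (hub b))
          from-petal j {i} i≤len (q , q<d , centre≡ , zero , _ , q+0≡D₀ , _) =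
            ⊥-elim (ℕ.m+n≮n 1 d (subst (_< d) (trans (sym (ℕ.+-identityʳ q)) q+0≡D₀) q<d))
          from-petal j {i} i≤len (q , q<d , centre≡ , suc zero , _ , q+1≡D₀ , _) =
            ⊥-elim (ℕ.m+n≮n 0 d (subst (_< d) (q+1≡D₀⇒q≡d q+1≡D₀) q<d))
          from-petal j {i} i≤len j∈Z@(q , q<d , centre≡ , suc (suc f) , _ , q+f≡D₀ , even≡) =
            petal⇝next j centre≡ i≤len (λ _ i′≤len → pv∈ (Z b) j i′≤len j∈Z) (C∈Z f (+2 q+f≡D₀) even≡)
            ++ʷ zigzag f (+2 q+f≡D₀) even≡

      Z-disjoint : ⟦ Z true ⟧ ⊥ ⟦ Z false ⟧
      Z-disjoint = regions-disjoint (Z true) (Z false) on-both λ (q , q<d , centre≡ , on-true) (q′ , q′<d , centre≡′ , on-false) →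
        on-both on-true (subst (OnZ false) (sym (rot-suc-injective r₀ (<d⇒<k q<d) (<d⇒<k q′<d) (trans (sym centre≡) centre≡′)))
                                on-false)
        where
          <d⇒<k : ∀ {q} → q < d → q < k
          <d⇒<k q<d = <6+d⇒<k (ℕ.<-≤-trans q<d (ℕ.m≤n+m d 6))

          on-both : ∀ {q} → OnZ true q → ¬ OnZ false q
          on-both {q} (f , _ , q+f≡D₀ , even-true) (f′ , _ , q+f′≡D₀ , even-false)
            with ℕ.+-cancelˡ-≡ q f f′ (trans q+f≡D₀ (sym q+f′≡D₀))
          ... | refl = case trans (sym even-true) even-false of λ ()

      Z⊥around : ∀ {b} a {bs} → 1 < toℕ a → ⟦ Z b ⟧ ⊥ ⟦ around a bs ⟧
      Z⊥around {b} a {bs} 1<a = regions-disjoint (Z b) (around a bs)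
        (λ { {q} (f , _ , q+f≡D₀ , _) refl →
               <-irrefl refl (<-≤-trans (ℕ.+-monoˡ-< d 1<a) (≤-trans (ℕ.m≤m+n q f) (ℕ.≤-reflexive q+f≡D₀))) })
        λ (q , q<d , centre≡ , _) b∈bs → let b , centre≡′ = Any.satisfied b∈bs in
          ℕ.m+n≮n (toℕ b) d (subst (_< d)
            (rot-suc-injective r₀ (<6+d⇒<k (ℕ.<-≤-trans q<d (ℕ.m≤n+m d 6))) (<6+d⇒<k (ℕ.+-monoˡ-< d (FinP.toℕ<n b)))
                               (trans (sym centre≡) centre≡′)) q<d)

      C₀∈Z : (⟦ Z true ⟧ ∪ᵖ ⟦ Z false ⟧) (C 0)
      C₀∈Z with even D₀ in even≡
      ... | true  = inj₁ (C∈Z D₀ refl even≡)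
      ... | false = inj₂ (C∈Z D₀ refl even≡)

      first∈ : ∀ S q → (∀ {i} → onPetal S (petal-at (suc q)) i) → ⟦ S ⟧ (pv (petal-at (suc q)) 0)
      first∈ S q on-petal = pv∈ S (petal-at (suc q)) z≤n on-petal

      last∈ : ∀ S q → (∀ {i} → onPetal S (petal-at q) i) → ⟦ S ⟧ (last-of q)
      last∈ S q on-petal = pv∈ S (petal-at q) ≤-refl on-petal

      first-of-adj : ∀ q → Adj G (pv (petal-at (suc q)) 0) (C q)
      first-of-adj q = first-adj (petal-at (suc q)) (centre-petal-at (suc q))

      Z-A′ : ∀ b → Touching G ⟦ Z b ⟧ ⟦ A′ ⟧
      Z-A′ b with even D₀ Bool.≟ b
      ... | yes even≡ = adjacent (C∈Z {q = 0} D₀ refl even≡) (centre∈around 5F)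
                                 (adj-sym (subst (Adj G _) (C-wrap 0) (C-adj (5 + d))))
      ... | no even≢  = adjacent (C∈Z {q = 1} d refl (not-injective (trans (sym (even-suc d)) (¬-not even≢))))
                                 (last∈ A′ (6 + d) (here (centre-petal-at (6 + d))))
                                 (adj-sym (subst (Adj G _) (C-wrap 1) (last-of-adj (6 + d))))

      bramble : Bramble G
      bramble = record
        { sets      = ⟦ A ⟧ ∷ ⟦ B ⟧ ∷ ⟦ Cʳ ⟧ ∷ (⟦ Z true ⟧ ∪ᵖ ⟦ A′ ⟧) ∷ (⟦ Z false ⟧ ∪ᵖ ⟦ A′ ⟧) ∷ (⟦ Z true ⟧ ∪ᵖ ⟦ Z false ⟧) ∷ []
        ; decidable = ⟦ A ⟧? ∷ ⟦ B ⟧? ∷ ⟦ Cʳ ⟧? ∷ (⟦ Z true ⟧? ∪? ⟦ A′ ⟧?) ∷ (⟦ Z false ⟧? ∪? ⟦ A′ ⟧?)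
                    ∷ (⟦ Z true ⟧? ∪? ⟦ Z false ⟧?) ∷ []
        ; connected = around-connected 2F (inj₁ refl ∷ inj₂ refl ∷ [])
                    ∷ around-connected 3F (inj₁ refl ∷ inj₂ refl ∷ [])
                    ∷ around-connected 4F (inj₁ refl ∷ [])
                    ∷ ∪-connected {G = G} (Z-connected true) A′-connected (Z-A′ true)
                    ∷ ∪-connected {G = G} (Z-connected false) A′-connected (Z-A′ false)
                    ∷ ∪-connected {G = G} (Z-connected true) (Z-connected false) (adjacent (hub∈Z true) (hub∈Z false) (adj-sym (C-adj d)))
                    ∷ []
        ; nonempty  = (_ , centre∈around 2F) ∷ (_ , centre∈around 3F) ∷ (_ , centre∈around 4F)
                    ∷ (_ , inj₂ (centre∈around 5F)) ∷ (_ , inj₂ (centre∈around 5F)) ∷ (_ , inj₁ (hub∈Z true)) ∷ []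
        ; touching  =
            ( adjacent (centre∈around 2F) (centre∈around 3F) (C-adj (2 + d))
            ∷ adjacent (last∈ A (3 + d) (here (centre-petal-at (3 + d)))) (centre∈around 4F) (last-of-adj (3 + d))
            ∷ adjacent (centre∈around 2F) (inj₁ (hub∈Z true)) (adj-sym (C-adj (1 + d)))
            ∷ adjacent (first∈ A d (there (here (centre-petal-at (1 + d))))) (inj₁ (hub∈Z false)) (first-of-adj d)
            ∷ adjacent (centre∈around 2F) (inj₁ (hub∈Z true)) (adj-sym (C-adj (1 + d)))
            ∷ [])
          ∷ ( adjacent (centre∈around 3F) (centre∈around 4F) (C-adj (3 + d))
            ∷ adjacent (first∈ B (1 + d) (there (here (centre-petal-at (2 + d))))) (inj₁ (hub∈Z true)) (first-of-adj (1 + d))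
            ∷ adjacent (last∈ B (4 + d) (here (centre-petal-at (4 + d)))) (inj₂ (centre∈around 5F)) (last-of-adj (4 + d))
            ∷ adjacent (first∈ B (1 + d) (there (here (centre-petal-at (2 + d))))) (inj₁ (hub∈Z true)) (first-of-adj (1 + d))
            ∷ [])
          ∷ ( adjacent (centre∈around 4F) (inj₂ (centre∈around 5F)) (C-adj (4 + d))
            ∷ adjacent (centre∈around 4F) (inj₂ (centre∈around 5F)) (C-adj (4 + d))
            ∷ adjacent (last∈ Cʳ (5 + d) (here (centre-petal-at (5 + d)))) C₀∈Z (subst (Adj G _) (C-wrap 0) (last-of-adj (5 + d)))
            ∷ [])
          ∷ (sharing (_ , inj₂ (centre∈around 5F) , inj₂ (centre∈around 5F)) ∷ sharing (_ , inj₁ (hub∈Z true) , inj₁ (hub∈Z true)) ∷ [])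
          ∷ (sharing (_ , inj₁ (hub∈Z false) , inj₂ (hub∈Z false)) ∷ [])
          ∷ [] ∷ [] }
        where
          A′-connected : Connected (Adj G) ⟦ A′ ⟧
          A′-connected = around-connected 5F (inj₁ refl ∷ [])

      disjoint : AllPairs _⊥_ (⟦ Z true ⟧ ∷ ⟦ Z false ⟧ ∷ ⟦ A′ ⟧ ∷ ⟦ A ⟧ ∷ ⟦ B ⟧ ∷ ⟦ Cʳ ⟧ ∷ [])
      disjoint = (Z-disjoint ∷ Z⊥around 5F 1<2+ ∷ Z⊥around 2F 1<2+ ∷ Z⊥around 3F 1<2+ ∷ Z⊥around 4F 1<2+ ∷ [])
               ∷ (Z⊥around 5F 1<2+ ∷ Z⊥around 2F 1<2+ ∷ Z⊥around 3F 1<2+ ∷ Z⊥around 4F 1<2+ ∷ [])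
               ∷ ( around-disjoint (λ ()) (((λ ()) ∷ (λ ()) ∷ []) ∷ [])
                 ∷ around-disjoint (λ ()) (((λ ()) ∷ (λ ()) ∷ []) ∷ [])
                 ∷ around-disjoint (λ ()) (((λ ()) ∷ []) ∷ []) ∷ [])
               ∷ ( around-disjoint (λ ()) (((λ ()) ∷ (λ ()) ∷ []) ∷ ((λ ()) ∷ (λ ()) ∷ []) ∷ [])
                 ∷ around-disjoint (λ ()) (((λ ()) ∷ []) ∷ ((λ ()) ∷ []) ∷ []) ∷ [])
               ∷ (around-disjoint (λ ()) (((λ ()) ∷ []) ∷ ((λ ()) ∷ []) ∷ []) ∷ [])
               ∷ [] ∷ []
        where
          1<2+ : ∀ {x} → 1 < 2 + x
          1<2+ = s≤s (s≤s z≤n)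

      five-hit : ∀ {p} → All (Meets p) (Bramble.sets bramble) → 5 ≤ ∣ p ∣
      five-hit {p} (A-hit ∷ B-hit ∷ C-hit ∷ ZA′-hit ∷ ZA′-hit′ ∷ ZZ-hit ∷ []) =
        hits-with-pairwise-unions p disjoint (A-hit ∷ B-hit ∷ C-hit ∷ []) ZZ-hit ZA′-hit ZA′-hit′

      lower-bound : ∀ w → TreewidthAtMost G w → 4 ≤ w
      lower-bound w (T , narrow) =
        let x , hits = bag-meeting-bramble T bramble in ≤-pred (≤-trans (five-hit hits) (narrow x))

    full-lower-bound : 5 ≤ k → ∀ w → TreewidthAtMost G w → 4 ≤ w
    full-lower-bound 5≤k with k ℕ.≟ 5
    ... | yes k≡5 = pentagon-lower-bound k≡5
    ... | no k≢5  = LongHole.lower-bound (k ∸ 6) (sym (ℕ.m+[n∸m]≡n (ℕ.≤∧≢⇒< 5≤k (k≢5 ∘ sym))))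

-- Upper bounds

module UpperBound {G : Graph n} (D : Daisy G) (r : Fin (Daisy.k D)) where
  open DaisyGeometry D
  open Anchored r

  k₂ : ℕ
  k₂ = k ∸ 2

  k≡2+k₂ : k ≡ 2 + k₂
  k≡2+k₂ = sym (ℕ.m+[n∸m]≡n (≤-trans (s≤s (s≤s z≤n)) 4≤k))

  longest : ℕ
  longest = max 0 (List.tabulate len)

  len≤longest : ∀ j → len j ≤ longest
  len≤longest = AllP.tabulate⁻ (xs≤max 0 (List.tabulate len))

  -- Legs are padded to a common length, so that the nodes can be numbered by a Fin.
  Node : Set
  Node = Fin (suc k₂) ⊎ (Fin m × Fin (suc longest))

  pattern spine e = inj₁ e
  pattern leg j i = inj₂ (j , i)

  -- Offsets from r: spine node e holds c_0 and the hole edge c_{e+1} c_{e+2}, and also c_1 resp. c_e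
  -- when the petal centred at c_0 resp. c_{e+1} hangs below it.
  data OnSpineAt (e : ℕ) : Pred (Fin k) 0ℓ where
    anchor       : OnSpineAt e (rot r 0)
    after-anchor : IsCentre (rot r 0) → OnSpineAt e (rot r 1)
    left         : OnSpineAt e (rot r (suc e))
    right        : OnSpineAt e (rot r (2 + e))
    before-left  : IsCentre (rot r (suc e)) → OnSpineAt e (rot r e)

  OnSpineAt? : ∀ e → Decidable (OnSpineAt e)
  OnSpineAt? e a with a Fin.≟ rot r 0 | IsCentre? (rot r 0) ×-dec (a Fin.≟ rot r 1) | a Fin.≟ rot r (suc e)
                    | a Fin.≟ rot r (2 + e) | IsCentre? (rot r (suc e)) ×-dec (a Fin.≟ rot r e)
  ... | yes refl | _               | _        | _        | _               = yes anchor
  ... | no _     | yes (c₀ , refl) | _        | _        | _               = yes (after-anchor c₀)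
  ... | no _     | no _            | yes refl | _        | _               = yes left
  ... | no _     | no _            | no _     | yes refl | _               = yes right
  ... | no _     | no _            | no _     | no _     | yes (cₑ , refl) = yes (before-left cₑ)
  ... | no ¬a    | no ¬aa          | no ¬l    | no ¬r    | no ¬bl          = no λ where
    anchor            → ¬a refl
    (after-anchor c₀) → ¬aa (c₀ , refl)
    left              → ¬l refl
    right             → ¬r refl
    (before-left cₑ)  → ¬bl (cₑ , refl)

  data OnLeg (j : Fin m) : ℕ → Pred (Fin k) 0ℓ where
    centre-on : ∀ {i} → OnLeg j i (centre j)
    next-on   : ∀ {i} → OnLeg j i (nxt (centre j))
    prev-on   : OnLeg j 0 (prv (centre j))

  OnLeg? : ∀ j i → Decidable (OnLeg j i)
  OnLeg? j i a with a Fin.≟ centre j | a Fin.≟ nxt (centre j) | (i ℕ.≟ 0) ×-dec (a Fin.≟ prv (centre j))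
  ... | yes refl | _        | _                 = yes centre-on
  ... | no _     | yes refl | _                 = yes next-on
  ... | no _     | no _     | yes (refl , refl) = yes prev-on
  ... | no ¬c    | no ¬n    | no ¬p             = no λ where
    centre-on → ¬c refl
    next-on   → ¬n refl
    prev-on   → ¬p (refl , refl)

  HoleOn : Node → Pred (Fin k) 0ℓ
  HoleOn (spine e) = OnSpineAt (toℕ e)
  HoleOn (leg j i) = OnLeg j (toℕ i)

  PetalOn : Node → ∀ j → Pred (Fin (suc (len j))) 0ℓ
  PetalOn (spine _) _  _ = Empty
  PetalOn (leg j i) j′ a = j ≡ j′ × (toℕ i ≡ toℕ a ⊎ toℕ i ≡ suc (toℕ a))

  PetalOn? : ∀ x j → Decidable (PetalOn x j)
  PetalOn? (spine _) _  _ = no λ ()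
  PetalOn? (leg j i) j′ a = (j Fin.≟ j′) ×-dec ((toℕ i ℕ.≟ toℕ a) ⊎-dec (toℕ i ℕ.≟ suc (toℕ a)))

  OnNode : Node → Pred (Fin n) 0ℓ
  OnNode x v = (∃[ a ] c a ≡ v × HoleOn x a) ⊎ (∃[ j ] ∃[ a ] Petal.p (petal j) a ≡ v × PetalOn x j a)

  OnNode? : ∀ x → Decidable (OnNode x)
  OnNode? x v = FinP.any? (λ a → (c a Fin.≟ v) ×-dec HoleOn? x a)
           ⊎-dec FinP.any? (λ j → FinP.any? λ a → (Petal.p (petal j) a Fin.≟ v) ×-dec PetalOn? x j a)
    where
      HoleOn? : ∀ x → Decidable (HoleOn x)
      HoleOn? (spine e) = OnSpineAt? (toℕ e)
      HoleOn? (leg j i) = OnLeg? j (toℕ i)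

  -- the spine node whose bag holds the neighbourhood of c_p
  spine-below : ℕ → Fin (suc k₂)
  spine-below zero    = Fin.fromℕ k₂
  spine-below (suc p) = clamp k₂ p

  attach : Fin m → Fin (suc k₂)
  attach j = spine-below (offset r (centre j))

  parent : Node → Node
  parent (spine fzero)    = spine fzero
  parent (spine (fsuc e)) = spine (Fin.inject₁ e)
  parent (leg j fzero)    = spine (attach j)
  parent (leg j (fsuc i)) = leg j (Fin.inject₁ i)

  depth : Node → ℕ
  depth (spine e) = toℕ e
  depth (leg j i) = suc k₂ + toℕ i

  parent-shallower : ∀ {x} → x ≢ spine fzero → depth (parent x) < depth x
  parent-shallower {spine fzero}    x≢root = ⊥-elim (x≢root refl)
  parent-shallower {spine (fsuc e)} _      = s≤s (ℕ.≤-reflexive (FinP.toℕ-inject₁ e))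
  parent-shallower {leg j fzero}    _      = subst (toℕ (attach j) <_) (sym (ℕ.+-identityʳ (suc k₂))) (FinP.toℕ<n (attach j))
  parent-shallower {leg j (fsuc i)} _      = ℕ.+-monoʳ-< (suc k₂) (s≤s (ℕ.≤-reflexive (FinP.toℕ-inject₁ i)))

  tree : RootedTree Node
  tree = record { root = spine fzero ; parent = parent ; depth = depth ; parent-shallower = parent-shallower }

  offset-view : ∀ a → ∃[ q ] q < k × a ≡ rot r q
  offset-view a = offset r a , offset<k r a , sym (rot-offset r a)

  spine-top : ℕ → Fin (suc k₂)
  spine-top q = clamp k₂ (q ∸ 2)

  q∸2≤k₂ : ∀ {q} → q < k → q ∸ 2 ≤ k₂
  q∸2≤k₂ {q} q<k = ℕ.∸-monoˡ-≤ 2 (ℕ.<⇒≤ (subst (q <_) k≡2+k₂ q<k))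

  at-clamp : ∀ {p a} → p ≤ k₂ → OnSpineAt p a → OnSpineAt (toℕ (clamp k₂ p)) a
  at-clamp {a = a} p≤k₂ = subst (λ e → OnSpineAt e a) (sym (toℕ-clamp k₂ p≤k₂))

  spine-top-holds : ∀ {q} → q < k → OnSpineAt (toℕ (spine-top q)) (rot r q)
  spine-top-holds {zero}        _   = anchor
  spine-top-holds {suc zero}    _   = left
  spine-top-holds {suc (suc q)} q<k = at-clamp (q∸2≤k₂ q<k) right

  root-is-top : ∀ {a} → OnSpineAt 0 a → spine-top (offset r a) ≡ fzero
  root-is-top anchor           = cong spine-top (offset-rot r 0<k)
  root-is-top (after-anchor _) = cong spine-top (offset-rot r (≤-trans (s≤s (s≤s z≤n)) 4≤k))
  root-is-top left             = cong spine-top (offset-rot r (≤-trans (s≤s (s≤s z≤n)) 4≤k))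
  root-is-top right            = cong spine-top (offset-rot r (≤-trans (s≤s (s≤s (s≤s z≤n))) 4≤k))
  root-is-top (before-left _)  = cong spine-top (offset-rot r 0<k)

  spine-climb : ∀ (e : Fin k₂) {a} → OnSpineAt (suc (toℕ e)) a → spine-top (offset r a) ≢ fsuc e → OnSpineAt (toℕ e) a
  spine-climb e anchor            _      = anchor
  spine-climb e (after-anchor c₀) _      = after-anchor c₀
  spine-climb e left              _      = right
  spine-climb e (before-left _)   _      = left
  spine-climb e right             not-top with ℕ.m≤n⇒m<n∨m≡n (subst (3 + toℕ e ≤_) (sym k≡2+k₂) (s≤s (s≤s (FinP.toℕ<n e))))
  ... | inj₁ 3+e<k = ⊥-elim (not-top (FinP.toℕ-injective (trans (cong (toℕ ∘ spine-top) (offset-rot r 3+e<k))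
                                                              (toℕ-clamp k₂ (FinP.toℕ<n e)))))
  ... | inj₂ 3+e≡k = subst (OnSpineAt (toℕ e)) (sym (trans (cong (rot r) 3+e≡k) (rot-+k r 0))) anchor

  attach-holds : ∀ j {a} → OnLeg j 0 a → OnSpineAt (toℕ (attach j)) a
  attach-holds j = below (offset<k r (centre j)) (sym (rot-offset r (centre j)))
    where
      p≤k₂ : ∀ {p} → suc p < k → p ≤ k₂
      p≤k₂ {p} 1+p<k = ℕ.≤-pred (ℕ.≤-pred (subst (suc (suc p) ≤_) k≡2+k₂ 1+p<k))

      rot-0≡rot-k : rot r 0 ≡ rot r (suc (suc k₂))
      rot-0≡rot-k = sym (trans (cong (rot r) (sym k≡2+k₂)) (rot-+k r 0))

      below : ∀ {p} → p < k → centre j ≡ rot r p → ∀ {a} → OnLeg j 0 a → OnSpineAt (toℕ (spine-below p)) a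
      below {zero} _ centre≡ centre-on = subst (OnSpineAt _) (sym centre≡) anchor
      below {zero} _ centre≡ next-on   =
        subst (OnSpineAt _) (sym (trans (cong nxt centre≡) (nxt-rot r 0))) (after-anchor (j , centre≡))
      below {zero} _ centre≡ prev-on   =
        subst (OnSpineAt _) (sym (trans (cong prv (trans centre≡ rot-0≡rot-k)) (prv-rot r (suc k₂))))
              (subst (λ e → OnSpineAt e (rot r (suc k₂))) (sym (FinP.toℕ-fromℕ k₂)) left)
      below {suc p} p<k centre≡ centre-on = subst (OnSpineAt _) (sym centre≡) (at-clamp (p≤k₂ p<k) left)
      below {suc p} p<k centre≡ next-on   =
        subst (OnSpineAt _) (sym (trans (cong nxt centre≡) (nxt-rot r (suc p)))) (at-clamp (p≤k₂ p<k) right)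
      below {suc p} p<k centre≡ prev-on   =
        subst (OnSpineAt _) (sym (trans (cong prv centre≡) (prv-rot r p))) (at-clamp (p≤k₂ p<k) (before-left (j , centre≡)))

  hole-top : Fin k → Node
  hole-top a = spine (spine-top (offset r a))

  hole-climb : ∀ {x a} → HoleOn x a → x ≢ hole-top a → x ≢ spine fzero × HoleOn (parent x) a
  hole-climb {spine fzero}    a∈x x≢top = ⊥-elim (x≢top (cong spine (sym (root-is-top a∈x))))
  hole-climb {spine (fsuc e)} a∈x x≢top =
    (λ ()) , subst (λ i → OnSpineAt i _) (sym (FinP.toℕ-inject₁ e)) (spine-climb e a∈x (x≢top ∘ cong spine ∘ sym))
  hole-climb {leg j fzero}    a∈x _     = (λ ()) , attach-holds j a∈x
  hole-climb {leg j (fsuc i)} a∈x _     = (λ ()) , subst (λ i′ → OnLeg j i′ _) (sym (FinP.toℕ-inject₁ i)) (step-up a∈x)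
    where
      step-up : ∀ {a} → OnLeg j (suc (toℕ i)) a → OnLeg j (toℕ i) a
      step-up centre-on = centre-on
      step-up next-on   = next-on

  petal-top : ∀ j → Fin (suc (len j)) → Node
  petal-top j a = leg j (Fin.inject≤ a (s≤s (len≤longest j)))

  petal-top-holds : ∀ j a → PetalOn (petal-top j a) j a
  petal-top-holds j a = refl , inj₁ (FinP.toℕ-inject≤ a _)

  petal-climb : ∀ {x j a} → PetalOn x j a → x ≢ petal-top j a → x ≢ spine fzero × PetalOn (parent x) j a
  petal-climb {leg j i} {a = a} (refl , inj₁ i≡a) x≢top =
    ⊥-elim (x≢top (cong (leg j) (FinP.toℕ-injective (trans i≡a (sym (FinP.toℕ-inject≤ a _))))))
  petal-climb {leg j fzero}    (refl , inj₂ ())      _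
  petal-climb {leg j (fsuc i)} (refl , inj₂ i≡1+a) _ =
    (λ ()) , refl , inj₁ (trans (FinP.toℕ-inject₁ i) (ℕ.suc-injective i≡1+a))

  hole-on : ∀ {x a} → HoleOn x a → OnNode x (c a)
  hole-on a∈x = inj₁ (_ , refl , a∈x)

  petal-on : ∀ {x j a} → PetalOn x j a → OnNode x (Petal.p (petal j) a)
  petal-on a∈x = inj₂ (_ , _ , refl , a∈x)

  highest : ∀ v → ∃[ h ] OnNode h v × (∀ {x} → OnNode x v → x ≢ h → x ≢ spine fzero × OnNode (parent x) v)
  highest v with covers v
  ... | inj₁ (a , refl) = hole-top a , hole-on (subst (OnSpineAt _) (rot-offset r a) (spine-top-holds (offset<k r a))) , λ where
    (inj₁ (a′ , ca′≡ca , a′∈x)) x≢h → case c-injective a′ a ca′≡ca of λ where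
      refl → let x≢root , a∈parent = hole-climb a′∈x x≢h in x≢root , inj₁ (a′ , ca′≡ca , a∈parent)
    (inj₂ (j , i , pi≡ca , _)) _ → ⊥-elim (pv≢c j i a pi≡ca)
  ... | inj₂ (j , a , refl) = petal-top j a , petal-on (petal-top-holds j a) , λ where
    (inj₁ (b , cb≡pa , _)) _ → ⊥-elim (pv≢c j a b (sym cb≡pa))
    (inj₂ (j′ , a′ , pa′≡pa , a′∈x)) x≢h → case same-petal pa′≡pa of λ where
      refl → case Petal.p-injective (petal j) a′ a pa′≡pa of λ where
        refl → let x≢root , a∈parent = petal-climb a′∈x x≢h in x≢root , inj₂ (j , a , pa′≡pa , a∈parent)

  hole-edge : ∀ a → ∃[ x ] HoleOn x a × HoleOn x (nxt a)
  hole-edge a with offset-view a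
  ... | zero  , _   , refl = spine fzero , anchor , subst (OnSpineAt 0) (sym (nxt-rot r 0)) left
  ... | suc q , q<k , refl = spine (clamp k₂ q) , at-clamp q≤k₂ left
                           , at-clamp q≤k₂ (subst (OnSpineAt q) (sym (nxt-rot r (suc q))) right)
    where
      q≤k₂ : q ≤ k₂
      q≤k₂ = ℕ.≤-pred (ℕ.≤-pred (subst (suc (suc q) ≤_) k≡2+k₂ q<k))

  petal-hole-edge : ∀ j i a → Adj G (Petal.p (petal j) i) (c a) → ∃[ x ] PetalOn x j i × HoleOn x a
  petal-hole-edge j i a pc with Petal.noOther (petal j) i a pc
  ... | inj₁ (refl , refl)        = leg j fzero , (refl , inj₁ refl) , prev-on
  ... | inj₂ (inj₁ (refl , refl)) = petal-top j i , petal-top-holds j i , next-on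
  ... | inj₂ (inj₂ (refl , _))    = petal-top j i , petal-top-holds j i , centre-on

  edge-covered : ∀ {u v} → Adj G u v → ∃[ x ] OnNode x u × OnNode x v
  edge-covered {u} {v} uv with covers u | covers v
  ... | inj₁ (a , refl) | inj₁ (b , refl) = case Equivalence.to (hole a b) uv of λ where
    (inj₁ refl) → let x , a∈x , b∈x = hole-edge a in x , hole-on a∈x , hole-on b∈x
    (inj₂ refl) → let x , b∈x , a∈x = hole-edge b in x , hole-on a∈x , hole-on b∈x
  ... | inj₁ (a , refl) | inj₂ (j , i , refl) =
    let x , i∈x , a∈x = petal-hole-edge j i a (adj-sym uv) in x , hole-on a∈x , petal-on i∈x
  ... | inj₂ (j , i , refl) | inj₁ (a , refl) =
    let x , i∈x , a∈x = petal-hole-edge j i a uv in x , petal-on i∈x , hole-on a∈x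
  ... | inj₂ (j , i , refl) | inj₂ (j′ , i′ , refl) with j Fin.≟ j′
  ...   | no j≢j′  = ⊥-elim (noPetalEdges j j′ i i′ j≢j′ uv)
  ...   | yes refl = case Equivalence.to (Petal.p-path (petal j) i i′) uv of λ where
    (inj₁ i′≡1+i) → petal-top j i′ , petal-on (refl , inj₂ (trans (FinP.toℕ-inject≤ i′ _) i′≡1+i))
                                   , petal-on (petal-top-holds j i′)
    (inj₂ i≡1+i′) → petal-top j i , petal-on (petal-top-holds j i)
                                  , petal-on (refl , inj₂ (trans (FinP.toℕ-inject≤ i _) i≡1+i′))

  decomposition : RootedDecomposition G tree
  decomposition = record { InBag = OnNode ; InBag? = OnNode? ; highest = highest ; edge-covered = edge-covered }

  Node↔ : Fin (suc (k₂ + m * suc longest)) ↔ Node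
  Node↔ = ↔-trans +↔⊎ (↔-refl ⊎-↔ *↔×)

  leg-vertices : Fin m → Fin (suc longest) → List (Fin n)
  leg-vertices j fzero    = c (centre j) ∷ c (nxt (centre j)) ∷ c (prv (centre j)) ∷ pv j 0 ∷ []
  leg-vertices j (fsuc i) = c (centre j) ∷ c (nxt (centre j)) ∷ pv j (toℕ i) ∷ pv j (suc (toℕ i)) ∷ []

  leg-vertices-length : ∀ j i → length (leg-vertices j i) ≡ 4
  leg-vertices-length j fzero    = refl
  leg-vertices-length j (fsuc i) = refl

  on-leg⇒listed : ∀ j i {v} → OnNode (leg j i) v → v ∈ₗ leg-vertices j i
  on-leg⇒listed j fzero    (inj₁ (_ , refl , centre-on)) = here refl
  on-leg⇒listed j (fsuc i) (inj₁ (_ , refl , centre-on)) = here refl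
  on-leg⇒listed j fzero    (inj₁ (_ , refl , next-on))   = there (here refl)
  on-leg⇒listed j (fsuc i) (inj₁ (_ , refl , next-on))   = there (here refl)
  on-leg⇒listed j fzero    (inj₁ (_ , refl , prev-on))   = there (there (here refl))
  on-leg⇒listed j fzero    (inj₂ (_ , a , refl , refl , inj₁ 0≡a)) =
    there (there (there (here (cong (Petal.p (petal j)) (FinP.toℕ-injective (sym 0≡a))))))
  on-leg⇒listed j (fsuc i) (inj₂ (_ , a , refl , refl , inj₁ 1+i≡a)) =
    there (there (there (here (trans (sym (pv-toℕ j a)) (cong (pv j) (sym 1+i≡a))))))
  on-leg⇒listed j (fsuc i) (inj₂ (_ , a , refl , refl , inj₂ 1+i≡1+a)) =
    there (there (here (trans (sym (pv-toℕ j a)) (cong (pv j) (sym (ℕ.suc-injective 1+i≡1+a))))))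

  treewidth≤ : ∀ {w} (spine-vertices : Fin (suc k₂) → List (Fin n)) → (∀ e → length (spine-vertices e) ≤ suc w) →
               (∀ e {a} → OnSpineAt (toℕ e) a → c a ∈ₗ spine-vertices e) → (Fin m → 3 ≤ w) → TreewidthAtMost G w
  treewidth≤ {w} spine-vertices spine-short spine-listed legs-fit =
    rooted-treewidth≤ (pull-decomposition Node↔ decomposition) (listing ∘ Inverse.to Node↔)
    where
      listing : ∀ x → ∃[ vs ] length vs ≤ suc w × (∀ {v} → OnNode x v → v ∈ₗ vs)
      listing (spine e) = spine-vertices e , spine-short e , λ where
        (inj₁ (_ , refl , a∈e)) → spine-listed e a∈e
        (inj₂ (_ , _ , _ , ()))
      listing (leg j i) = leg-vertices j i , subst (_≤ suc w) (sym (leg-vertices-length j i)) (s≤s (legs-fit j))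
                        , on-leg⇒listed j i

  treewidth≤4 : TreewidthAtMost G 4
  treewidth≤4 = treewidth≤ spine-vertices (λ _ → ≤-refl) listed (λ _ → s≤s (s≤s (s≤s z≤n)))
    where
      spine-vertices : Fin (suc k₂) → List (Fin n)
      spine-vertices e = C 0 ∷ C 1 ∷ C (suc (toℕ e)) ∷ C (2 + toℕ e) ∷ C (toℕ e) ∷ []

      listed : ∀ e {a} → OnSpineAt (toℕ e) a → c a ∈ₗ spine-vertices e
      listed e anchor           = here refl
      listed e (after-anchor _) = there (here refl)
      listed e left             = there (there (here refl))
      listed e right            = there (there (there (here refl)))
      listed e (before-left _)  = there (there (there (there (here refl))))

  treewidth≤3-off-centre : ¬ IsCentre r → TreewidthAtMost G 3
  treewidth≤3-off-centre r-bare = treewidth≤ spine-vertices (λ _ → ≤-refl) listed (λ _ → ≤-refl)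
    where
      spine-vertices : Fin (suc k₂) → List (Fin n)
      spine-vertices e = C 0 ∷ C (suc (toℕ e)) ∷ C (2 + toℕ e) ∷ C (toℕ e) ∷ []

      listed : ∀ e {a} → OnSpineAt (toℕ e) a → c a ∈ₗ spine-vertices e
      listed e anchor            = here refl
      listed e (after-anchor r∈) = ⊥-elim (r-bare (subst IsCentre (rot-0 r) r∈))
      listed e left              = there (here refl)
      listed e right             = there (there (here refl))
      listed e (before-left _)   = there (there (there (here refl)))

  treewidth≤3-square : k ≡ 4 → TreewidthAtMost G 3
  treewidth≤3-square k≡4 = treewidth≤ (λ _ → C 0 ∷ C 1 ∷ C 2 ∷ C 3 ∷ []) (λ _ → ≤-refl) listed (λ _ → ≤-refl)
    where
      listed : ∀ e {a} → OnSpineAt (toℕ e) a → c a ∈ₗ C 0 ∷ C 1 ∷ C 2 ∷ C 3 ∷ []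
      listed _ {a} _ with offset-view a
      ... | q , q<k , refl = at (subst (q <_) k≡4 q<k)
        where
          at : ∀ {q} → q < 4 → C q ∈ₗ C 0 ∷ C 1 ∷ C 2 ∷ C 3 ∷ []
          at {0} _ = here refl
          at {1} _ = there (here refl)
          at {2} _ = there (there (here refl))
          at {3} _ = there (there (there (here refl)))
          at {suc (suc (suc (suc _)))} (s≤s (s≤s (s≤s (s≤s ()))))

  treewidth≤2-no-petals : m ≡ 0 → TreewidthAtMost G 2
  treewidth≤2-no-petals m≡0 = treewidth≤ spine-vertices (λ _ → ≤-refl) listed no-petal
    where
      no-petal : ∀ {A : Set} → Fin m → A
      no-petal j = ⊥-elim (FinP.¬Fin0 (subst Fin m≡0 j))

      spine-vertices : Fin (suc k₂) → List (Fin n)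
      spine-vertices e = C 0 ∷ C (suc (toℕ e)) ∷ C (2 + toℕ e) ∷ []

      listed : ∀ e {a} → OnSpineAt (toℕ e) a → c a ∈ₗ spine-vertices e
      listed e anchor                = here refl
      listed e (after-anchor (j , _)) = no-petal j
      listed e left                  = there (here refl)
      listed e right                 = there (there (here refl))
      listed e (before-left (j , _)) = no-petal j

lemmal : ∀ {n} (G : Graph n) (D : Daisy G) →
           ((Full D × 5 ≤ Daisy.k D) → HasTreewidth G 4)
         × (NoPetal D → HasTreewidth G 2)
         × (¬ (Full D × 5 ≤ Daisy.k D) → ¬ NoPetal D → HasTreewidth G 3)
lemmal G D =
    (λ (full , 5≤k) → UpperBound.treewidth≤4 D r₀ , LowerBounds.full-lower-bound D full 5≤k)
  , (λ no-petals → UpperBound.treewidth≤2-no-petals D r₀ no-petals , LowerBounds.hole-lower-bound D)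
  , (λ not-full-long has-petals → treewidth≤3 not-full-long
                                , LowerBounds.petal-lower-bound D (Fin.fromℕ< (ℕ.n≢0⇒n>0 has-petals)))
  where
    open DaisyGeometry D using (k; 4≤k; r₀; IsCentre?)

    treewidth≤3 : ¬ (Full D × 5 ≤ k) → TreewidthAtMost G 3
    treewidth≤3 not-full-long with FinP.all? IsCentre?
    ... | yes full    = UpperBound.treewidth≤3-square D r₀ (ℕ.≤-antisym (ℕ.≮⇒≥ (λ 4<k → not-full-long (full , 4<k))) 4≤k)
    ... | no not-full = let i , i-bare = FinP.¬∀⟶∃¬ k _ IsCentre? not-full in UpperBound.treewidth≤3-off-centre D i i-bare
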